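{- Let $k$ be a divisor of $m$ with $\gcd(2^m-1,2^k+1)=1$, let $e=2^m-2^k-2$ and let $d$ be the integer with $de\equiv1\pmod{2^m-1}$. Let $\{\alpha_0,\dots,\alpha_{k-1}\}$ be a basis of $\mathbb{F}_{2^k}$ over $\mathbb{F}_2$ and define $f_1,f_2:\mathbb{F}_{2^m}\times\mathbb{F}_{2^m}\to\mathbb{Z}_{2^k}$ by $f_1(x,y)=\sum_{i=0}^{k-1}{\rm Tr}_m(\alpha_ixy^d)2^i$ and $f_2(x,y)=\sum_{i=0}^{k-1}{\rm Tr}_m(\alpha_i^{ -e}x^ey)2^i$. Let $\Gamma_1=\{f_2^{ -1}(i):i\in\mathbb{Z}_{2^k}\}$ and $\Gamma_2=\{f_1^{ -1}(i):i\in\mathbb{Z}_{2^k}\}$ be the partitions of $\mathbb{F}_{2^m}\times\mathbb{F}_{2^m}$ into preimages. Then \[ \Gamma_1=\{\mathcal{A}(0)\cup U,\ \mathcal{A}(\gamma):\gamma\in\mathbb{F}_{2^k}^*\},\qquad \Gamma_2=\{\mathcal{B}(0)\cup V,\ \mathcal{B}(\gamma):\gamma\in\mathbb{F}_{2^k}^*\}, \] where $\mathcal{A}(0)\cup U=f_2^{ -1}(0)$ and $\mathcal{B}(0)\cup V=f_1^{ -1}(0)$.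
   Context: ${\rm Tr}_m$ is the absolute trace $\mathbb{F}_{2^m}\to\mathbb{F}_2$ (values regarded as integers $0,1$, sums in $\mathbb{Z}_{2^k}$), ${\rm Tr}^m_k$ is the relative trace $\mathbb{F}_{2^m}\to\mathbb{F}_{2^k}$. Powers of nonzero elements have exponents modulo $2^m-1$; all powers of $0$ equal $0$. Define $U=\{(0,y):y\in\mathbb{F}_{2^m}\}$, $V=\{(x,0):x\in\mathbb{F}_{2^m}\}$, and for $s\in\mathbb{F}_{2^m}$: $U_s=\{(x,sx^{ -e}):x\in\mathbb{F}_{2^m}\}$, $V_s=\{(x^{ -d}s,x):x\in\mathbb{F}_{2^m}\}$, $U_s^*=U_s\setminus\{(0,0)\}$, $V_s^*=V_s\setminus\{(0,0)\}$. For $\gamma\in\mathbb{F}_{2^k}$, $\mathcal{A}(\gamma)=\bigcup_{s\in\mathbb{F}_{2^m},\,{\rm Tr}^m_k(s)=\gamma}U_s^*$ and $\mathcal{B}(\gamma)=\bigcup_{s\in\mathbb{F}_{2^m},\,{\rm Tr}^m_k(s)=\gamma}V_s^*$. -}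

module Defs where

open import Level using (Level; _⊔_) renaming (suc to lsuc)
open import Data.Nat as ℕ using (ℕ; zero; suc)
open import Data.Nat.Divisibility using (_∣_)
open import Data.Integer as ℤ using (ℤ; +_)
open import Data.Fin using (Fin; toℕ)
open import Data.Bool using (Bool; true; false; if_then_else_)
open import Data.Product using (Σ; _×_; _,_; ∃)
open import Data.Sum using (_⊎_; inj₁; inj₂)
open import Data.Unit using (⊤)
open import Relation.Binary.PropositionalEquality using (_≡_)
open import Relation.Nullary using (¬_; Dec; yes; no)
open import Function.Bundles using (_↔_)
open import Algebra.Structures using (IsCommutativeRing)

-- A finite field with exactly 2^m elements (characteristic 2), with
-- propositional equality.  Every such field is isomorphic to F_{2^m}.

record GF (m : ℕ) : Set₁ where
  infixl 6 _+_
  infixl 7 _*_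
  field
    Carrier : Set
    _+_ _*_ : Carrier → Carrier → Carrier
    -_ : Carrier → Carrier
    0# 1# : Carrier
    isCommutativeRing : IsCommutativeRing _≡_ _+_ _*_ -_ 0# 1#
    _≟_ : (x y : Carrier) → Dec (x ≡ y)
    0≢1 : ¬ (0# ≡ 1#)
    inverse : ∀ x → ¬ (x ≡ 0#) → Σ Carrier λ y → x * y ≡ 1#
    char2 : 1# + 1# ≡ 0#
    enumeration : Fin (2 ℕ.^ m) ↔ Carrier

module Field {m : ℕ} (F : GF m) where
  open GF F public

  _^_ : Carrier → ℕ → Carrier
  x ^ zero  = 1#
  x ^ suc n = x * (x ^ n)

  N : ℕ
  N = 2 ℕ.^ m ℕ.∸ 1

  redExp : ℤ → ℕ
  redExp z with N
  ... | zero  = 0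
  ... | suc n = z ℤ.%ℕ suc n

  -- integer powers: exponent taken modulo 2^m - 1, all powers of 0 are 0
  pw : Carrier → ℤ → Carrier
  pw x z with x ≟ 0#
  ... | yes _ = 0#
  ... | no  _ = x ^ redExp z

  sumF : (n : ℕ) → (ℕ → Carrier) → Carrier
  sumF zero    f = 0#
  sumF (suc n) f = sumF n f + f n

  Tr : Carrier → Carrier
  Tr x = sumF m λ j → x ^ (2 ℕ.^ j)

  RelTr : (k : ℕ) → k ∣ m → Carrier → Carrier
  RelTr k k∣m s = sumF (_∣_.quotient k∣m) λ j → s ^ (2 ℕ.^ (k ℕ.* j))

  InSub : ℕ → Carrier → Set
  InSub k γ = γ ^ (2 ℕ.^ k) ≡ γ

  -- an element of F_2 ⊆ F regarded as the integer 0 or 1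
  bit : Carrier → ℕ
  bit x with x ≟ 0#
  ... | yes _ = 0
  ... | no  _ = 1

  comb : (k : ℕ) → (Fin k → Bool) → (Fin k → Carrier) → Carrier
  comb k b α = sumF k λ i → go i
    where
    go : ℕ → Carrier
    go i with i ℕ.<? k
    ... | yes i<k = if b (Data.Fin.fromℕ< i<k) then α (Data.Fin.fromℕ< i<k) else 0#
    ... | no  _   = 0#

  IsBasis : (k : ℕ) → (Fin k → Carrier) → Set
  IsBasis k α =
    (∀ i → InSub k (α i))
    × (∀ (b : Fin k → Bool) → comb k b α ≡ 0# → ∀ i → b i ≡ false)
    × (∀ y → InSub k y → Σ (Fin k → Bool) λ b → comb k b α ≡ y)

  -- Σ_{i<k} t(i) 2^i as a natural number (this is < 2^k, so it is the
  -- value in Z_{2^k})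
  weighted : (k : ℕ) → (Fin k → ℕ) → ℕ
  weighted zero    t = 0
  weighted (suc k) t = t Data.Fin.zero ℕ.+ 2 ℕ.* weighted k (λ i → t (Data.Fin.suc i))

  Pt : Set
  Pt = Carrier × Carrier

  Pred : Set₁
  Pred = Pt → Set

  f₁ : (k : ℕ) → (Fin k → Carrier) → (d : ℤ) → Pt → ℕ
  f₁ k α d (x , y) = weighted k λ i → bit (Tr (α i * x * pw y d))

  f₂ : (k : ℕ) → (Fin k → Carrier) → (e : ℤ) → Pt → ℕ
  f₂ k α e (x , y) = weighted k λ i → bit (Tr (pw (α i) (ℤ.- e) * pw x e * y))

  preimage : (Pt → ℕ) → ℕ → Pred
  preimage f i p = f p ≡ i

  U V : Pred
  U (x , y) = x ≡ 0#
  V (x , y) = y ≡ 0#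

  Us : ℤ → Carrier → Pred
  Us e s (a , b) = b ≡ s * pw a (ℤ.- e)

  Vs : ℤ → Carrier → Pred
  Vs d s (a , b) = a ≡ pw b (ℤ.- d) * s

  NonOrigin : Pred
  NonOrigin (a , b) = ¬ ((a ≡ 0#) × (b ≡ 0#))

  𝒜 : (k : ℕ) → k ∣ m → ℤ → Carrier → Pred
  𝒜 k k∣m e γ p = Σ Carrier λ s → (RelTr k k∣m s ≡ γ) × Us e s p × NonOrigin p

  ℬ : (k : ℕ) → k ∣ m → ℤ → Carrier → Pred
  ℬ k k∣m d γ p = Σ Carrier λ s → (RelTr k k∣m s ≡ γ) × Vs d s p × NonOrigin p

  _∪_ : Pred → Pred → Pred
  (P ∪ Q) p = P p ⊎ Q p

  _≐_ : Pred → Pred → Set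
  P ≐ Q = ∀ p → (P p → Q p) × (Q p → P p)

  Idx : ℕ → Set
  Idx k = ⊤ ⊎ Σ Carrier λ γ → InSub k γ × ¬ (γ ≡ 0#)

  SameFamily : {I J : Set} → (I → Pred) → (J → Pred) → Set
  SameFamily {I} {J} P Q =
    (∀ i → Σ J λ j → P i ≐ Q j) × (∀ j → Σ I λ i → Q j ≐ P i)

  Γ₁ Γ₂ : (k : ℕ) → (Fin k → Carrier) → ℤ → Fin (2 ℕ.^ k) → Pred
  Γ₁ k α e i = preimage (f₂ k α e) (toℕ i)
  Γ₂ k α d i = preimage (f₁ k α d) (toℕ i)

  famA : (k : ℕ) → k ∣ m → ℤ → Idx k → Pred
  famA k k∣m e (inj₁ _)       = 𝒜 k k∣m e 0# ∪ U
  famA k k∣m e (inj₂ (γ , _)) = 𝒜 k k∣m e γ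

  famB : (k : ℕ) → k ∣ m → ℤ → Idx k → Pred
  famB k k∣m d (inj₁ _)       = ℬ k k∣m d 0# ∪ V
  famB k k∣m d (inj₂ (γ , _)) = ℬ k k∣m d γ

{-# OPTIONS --safe #-}
-- For x ≢ 0 the point (x , y) lies on U_s exactly when s = x^e y, and on V_s exactly when
-- s = y^d x, so off the axes 𝒜(γ) and ℬ(γ) are the fibres over γ of (x , y) ↦ Tr^m_k(x^e y)
-- and (x , y) ↦ Tr^m_k(y^d x), while the axes U and V are sent to 0 (powers of 0 are 0).
-- Because α_i ∈ 𝔽_{2^k} and −e ≡ 2^k + 1 (mod 2^m − 1), α_i^{−e} = α_i², and transitivity
-- of the trace, Tr_m(a s) = Tr_k(a Tr^m_k(s)) for a ∈ 𝔽_{2^k}, turns f₂ and f₁ into W ∘ Tr^m_k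
-- with W(γ) = Σ_i Tr_k(β_i γ) 2^i for the bases β = α² and β = α respectively.  Such a W is
-- a bijection 𝔽_{2^k} → ℤ_{2^k} with W(0) = 0: it is injective because the trace form is
-- nondegenerate (Tr_m is a nonzero polynomial of degree 2^{m−1} < 2^m, hence not identically
-- zero on 𝔽_{2^m}), and then surjective by counting.
module Submission where

open import Defs
import Data.Nat as ℕ
open ℕ using (ℕ; zero; suc; _≤_; _<_; z≤n; s≤s; ⌊_/2⌋)
import Data.Nat.Properties as ℕₚ
import Data.Nat.DivMod as ℕ÷
open import Data.Nat.Divisibility using (_∣_; divides)
import Data.Integer as ℤ
open ℤ using (ℤ)
import Data.Integer.Properties as ℤₚ
import Data.Integer.DivMod as ℤ÷
import Data.Integer.Divisibility.Signed as ℤ∣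
open import Data.Integer.Tactic.RingSolver using (solve-∀)
open import Data.Fin as Fin using (Fin; toℕ; fromℕ<)
import Data.Fin.Properties as Finₚ
open import Data.Fin.Permutation using (Permutation′; permutation)
open import Data.Bool using (Bool; true; false; if_then_else_; _xor_)
open import Data.List using (List; []; _∷_; length)
open import Data.List.Relation.Unary.All using (All; []; _∷_)
open import Data.Product using (Σ; _×_; _,_; proj₁; proj₂; swap)
open import Data.Sum using (_⊎_; inj₁; inj₂)
open import Data.Unit using (tt)
open import Data.Empty using (⊥-elim)
open import Function.Base using (_∘′_)
open import Function.Bundles using (Inverse)
open import Relation.Binary.PropositionalEquality
open import Relation.Nullary
open import Algebra.Bundles using (CommutativeRing)
import Algebra.Properties.CommutativeMonoid.Sum as MonoidSum

module Char2Arithmetic {m : ℕ} (F : GF m) where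
  open Field F public

  commutativeRing : CommutativeRing _ _
  commutativeRing = record { isCommutativeRing = isCommutativeRing }

  open CommutativeRing commutativeRing public
    using ( +-assoc; +-identityˡ; +-identityʳ; *-assoc; *-comm; *-identityˡ; *-identityʳ
          ; zeroˡ; zeroʳ; distribˡ; distribʳ)
  open import Algebra.Solver.Ring.NaturalCoefficients.Default
    (CommutativeRing.commutativeSemiring commutativeRing) public
    using (solve; _:=_; _:+_; _:*_)

  1≢0 : ¬ 1# ≡ 0#
  1≢0 e = 0≢1 (sym e)

  x+x≡0 : ∀ x → x + x ≡ 0#
  x+x≡0 x = begin
    x + x               ≡⟨ cong₂ _+_ (sym (*-identityʳ x)) (sym (*-identityʳ x)) ⟩
    x * 1# + x * 1#     ≡⟨ distribˡ x 1# 1# ⟨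
    x * (1# + 1#)       ≡⟨ cong (x *_) char2 ⟩
    x * 0#              ≡⟨ zeroʳ x ⟩
    0#                  ∎
    where open ≡-Reasoning

  +≡0⇒≡ : ∀ {a b} → a + b ≡ 0# → a ≡ b
  +≡0⇒≡ {a} {b} a+b≡0 = begin
    a               ≡⟨ +-identityʳ a ⟨
    a + 0#          ≡⟨ cong (a +_) (x+x≡0 b) ⟨
    a + (b + b)     ≡⟨ +-assoc a b b ⟨
    (a + b) + b     ≡⟨ cong (_+ b) a+b≡0 ⟩
    0# + b          ≡⟨ +-identityˡ b ⟩
    b               ∎
    where open ≡-Reasoning

  ≡⇒+≡0 : ∀ {a b} → a ≡ b → a + b ≡ 0#
  ≡⇒+≡0 {a} refl = x+x≡0 a

  x*y≡0⇒x≡0⊎y≡0 : ∀ {x y} → x * y ≡ 0# → x ≡ 0# ⊎ y ≡ 0#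
  x*y≡0⇒x≡0⊎y≡0 {x} {y} xy≡0 with x ≟ 0#
  ... | yes x≡0 = inj₁ x≡0
  ... | no x≢0 = inj₂ (begin
    y                ≡⟨ *-identityˡ y ⟨
    1# * y           ≡⟨ cong (_* y) x*x⁻¹≡1 ⟨
    (x * x⁻¹) * y    ≡⟨ solve 3 (λ x x⁻¹ y → (x :* x⁻¹) :* y := x⁻¹ :* (x :* y)) refl x x⁻¹ y ⟩
    x⁻¹ * (x * y)    ≡⟨ cong (x⁻¹ *_) xy≡0 ⟩
    x⁻¹ * 0#         ≡⟨ zeroʳ x⁻¹ ⟩
    0#               ∎)
    where
    open ≡-Reasoning
    x⁻¹ : Carrier
    x⁻¹ = proj₁ (inverse x x≢0)
    x*x⁻¹≡1 : x * x⁻¹ ≡ 1#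
    x*x⁻¹≡1 = proj₂ (inverse x x≢0)

  *-≢0 : ∀ {x y} → ¬ x ≡ 0# → ¬ y ≡ 0# → ¬ x * y ≡ 0#
  *-≢0 x≢0 y≢0 xy≡0 with x*y≡0⇒x≡0⊎y≡0 xy≡0
  ... | inj₁ x≡0 = x≢0 x≡0
  ... | inj₂ y≡0 = y≢0 y≡0

  *-cancelˡ : ∀ {a b c} → ¬ a ≡ 0# → a * b ≡ a * c → b ≡ c
  *-cancelˡ {a} {b} {c} a≢0 ab≡ac with x*y≡0⇒x≡0⊎y≡0 (trans (distribˡ a b c) (≡⇒+≡0 ab≡ac))
  ... | inj₁ a≡0 = ⊥-elim (a≢0 a≡0)
  ... | inj₂ b+c≡0 = +≡0⇒≡ b+c≡0

  ^-distribˡ-+-* : ∀ x a b → x ^ (a ℕ.+ b) ≡ x ^ a * x ^ b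
  ^-distribˡ-+-* x zero b = sym (*-identityˡ _)
  ^-distribˡ-+-* x (suc a) b = trans (cong (x *_) (^-distribˡ-+-* x a b)) (sym (*-assoc _ _ _))

  ^-*-assoc : ∀ x a b → (x ^ a) ^ b ≡ x ^ (a ℕ.* b)
  ^-*-assoc x a zero = cong (x ^_) (sym (ℕₚ.*-zeroʳ a))
  ^-*-assoc x a (suc b) = begin
    x ^ a * (x ^ a) ^ b        ≡⟨ cong (x ^ a *_) (^-*-assoc x a b) ⟩
    x ^ a * x ^ (a ℕ.* b)      ≡⟨ ^-distribˡ-+-* x a (a ℕ.* b) ⟨
    x ^ (a ℕ.+ a ℕ.* b)        ≡⟨ cong (x ^_) (ℕₚ.*-suc a b) ⟨
    x ^ (a ℕ.* suc b)          ∎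
    where open ≡-Reasoning

  ^-distribʳ-* : ∀ x y n → (x * y) ^ n ≡ x ^ n * y ^ n
  ^-distribʳ-* x y zero = sym (*-identityˡ _)
  ^-distribʳ-* x y (suc n) = trans (cong ((x * y) *_) (^-distribʳ-* x y n))
    (solve 4 (λ x y a b → (x :* y) :* (a :* b) := (x :* a) :* (y :* b)) refl x y (x ^ n) (y ^ n))

  1^n≡1 : ∀ n → 1# ^ n ≡ 1#
  1^n≡1 zero = refl
  1^n≡1 (suc n) = trans (*-identityˡ _) (1^n≡1 n)

  ^-identityʳ : ∀ x → x ^ 1 ≡ x
  ^-identityʳ = *-identityʳ

  ^-≢0 : ∀ {x} n → ¬ x ≡ 0# → ¬ x ^ n ≡ 0#
  ^-≢0 zero x≢0 = 1≢0
  ^-≢0 (suc n) x≢0 = *-≢0 x≢0 (^-≢0 n x≢0)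

  square-+ : ∀ a b → (a + b) ^ 2 ≡ a ^ 2 + b ^ 2
  square-+ a b = begin
    (a + b) ^ 2                                      ≡⟨ solve 3 (λ a b o →
        (a :+ b) :* ((a :+ b) :* o)
          := (a :* (a :* o) :+ b :* (b :* o)) :+ ((a :* b) :* o :+ (a :* b) :* o)) refl a b 1# ⟩
    (a ^ 2 + b ^ 2) + ((a * b) * 1# + (a * b) * 1#) ≡⟨ cong ((a ^ 2 + b ^ 2) +_) (x+x≡0 _) ⟩
    (a ^ 2 + b ^ 2) + 0#                             ≡⟨ +-identityʳ _ ⟩
    a ^ 2 + b ^ 2                                    ∎
    where open ≡-Reasoning

  frobenius-suc : ∀ x j → x ^ (2 ℕ.^ suc j) ≡ (x ^ (2 ℕ.^ j)) ^ 2
  frobenius-suc x j = trans (cong (x ^_) (ℕₚ.*-comm 2 (2 ℕ.^ j))) (sym (^-*-assoc x (2 ℕ.^ j) 2))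

  frobenius-∘ : ∀ x a b → (x ^ (2 ℕ.^ a)) ^ (2 ℕ.^ b) ≡ x ^ (2 ℕ.^ (a ℕ.+ b))
  frobenius-∘ x a b = trans (^-*-assoc x (2 ℕ.^ a) (2 ℕ.^ b)) (cong (x ^_) (sym (ℕₚ.^-distribˡ-+-* 2 a b)))

  frobenius-+ : ∀ a b j → (a + b) ^ (2 ℕ.^ j) ≡ a ^ (2 ℕ.^ j) + b ^ (2 ℕ.^ j)
  frobenius-+ a b zero = trans (^-identityʳ _) (sym (cong₂ _+_ (^-identityʳ a) (^-identityʳ b)))
  frobenius-+ a b (suc j) = begin
    (a + b) ^ (2 ℕ.^ suc j)                              ≡⟨ frobenius-suc (a + b) j ⟩
    ((a + b) ^ (2 ℕ.^ j)) ^ 2                            ≡⟨ cong (_^ 2) (frobenius-+ a b j) ⟩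
    (a ^ (2 ℕ.^ j) + b ^ (2 ℕ.^ j)) ^ 2                  ≡⟨ square-+ _ _ ⟩
    (a ^ (2 ℕ.^ j)) ^ 2 + (b ^ (2 ℕ.^ j)) ^ 2            ≡⟨ cong₂ _+_ (frobenius-suc a j) (frobenius-suc b j) ⟨
    a ^ (2 ℕ.^ suc j) + b ^ (2 ℕ.^ suc j)                ∎
    where open ≡-Reasoning

  frobenius-0 : ∀ j → 0# ^ (2 ℕ.^ j) ≡ 0#
  frobenius-0 j with 2 ℕ.^ j | ℕₚ.m^n>0 2 j
  ... | suc _ | _ = zeroˡ _

  sumF-cong : ∀ n {f g} → (∀ i → f i ≡ g i) → sumF n f ≡ sumF n g
  sumF-cong zero f≗g = refl
  sumF-cong (suc n) f≗g = cong₂ _+_ (sumF-cong n f≗g) (f≗g n)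

  sumF-zero : ∀ n → sumF n (λ _ → 0#) ≡ 0#
  sumF-zero zero = refl
  sumF-zero (suc n) = trans (+-identityʳ _) (sumF-zero n)

  sumF-distrib-+ : ∀ n f g → sumF n (λ i → f i + g i) ≡ sumF n f + sumF n g
  sumF-distrib-+ zero f g = sym (+-identityˡ _)
  sumF-distrib-+ (suc n) f g = trans (cong (_+ (f n + g n)) (sumF-distrib-+ n f g))
    (solve 4 (λ a b c d → (a :+ b) :+ (c :+ d) := (a :+ c) :+ (b :+ d)) refl _ _ _ _)

  *-distribˡ-sumF : ∀ n c f → c * sumF n f ≡ sumF n (λ i → c * f i)
  *-distribˡ-sumF zero c f = zeroʳ c
  *-distribˡ-sumF (suc n) c f = trans (distribˡ c _ _) (cong (_+ (c * f n)) (*-distribˡ-sumF n c f))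

  frobenius-sumF : ∀ n f j → sumF n f ^ (2 ℕ.^ j) ≡ sumF n (λ i → f i ^ (2 ℕ.^ j))
  frobenius-sumF zero f j = frobenius-0 j
  frobenius-sumF (suc n) f j = trans (frobenius-+ _ _ j) (cong (_+ f n ^ (2 ℕ.^ j)) (frobenius-sumF n f j))

  sumF-suc : ∀ n f → sumF (suc n) f ≡ f 0 + sumF n (λ i → f (suc i))
  sumF-suc zero f = trans (+-identityˡ _) (sym (+-identityʳ _))
  sumF-suc (suc n) f = trans (cong (_+ f (suc n)) (sumF-suc n f)) (+-assoc _ _ _)

  sumF-rotate : ∀ n f → f n ≡ f 0 → sumF n (λ i → f (suc i)) ≡ sumF n f
  sumF-rotate n f fn≡f0 = begin
    S′                    ≡⟨ +-identityʳ S′ ⟨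
    S′ + 0#               ≡⟨ cong (S′ +_) (x+x≡0 (f 0)) ⟨
    S′ + (f 0 + f 0)      ≡⟨ solve 2 (λ a s → s :+ (a :+ a) := (a :+ s) :+ a) refl (f 0) S′ ⟩
    (f 0 + S′) + f 0      ≡⟨ cong (_+ f 0) (sumF-suc n f) ⟨
    sumF n f + f n + f 0  ≡⟨ cong (λ z → sumF n f + z + f 0) fn≡f0 ⟩
    sumF n f + f 0 + f 0  ≡⟨ +-assoc _ _ _ ⟩
    sumF n f + (f 0 + f 0) ≡⟨ cong (sumF n f +_) (x+x≡0 (f 0)) ⟩
    sumF n f + 0#         ≡⟨ +-identityʳ _ ⟩
    sumF n f              ∎
    where
    open ≡-Reasoning
    S′ : Carrier
    S′ = sumF n (λ i → f (suc i))

  sumF-split : ∀ a b f → sumF (a ℕ.+ b) f ≡ sumF a f + sumF b (λ i → f (a ℕ.+ i))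
  sumF-split a zero f = trans (cong (λ z → sumF z f) (ℕₚ.+-identityʳ a)) (sym (+-identityʳ _))
  sumF-split a (suc b) f = begin
    sumF (a ℕ.+ suc b) f                                ≡⟨ cong (λ z → sumF z f) (ℕₚ.+-suc a b) ⟩
    sumF (a ℕ.+ b) f + f (a ℕ.+ b)                      ≡⟨ cong (_+ f (a ℕ.+ b)) (sumF-split a b f) ⟩
    (sumF a f + sumF b (λ i → f (a ℕ.+ i))) + f (a ℕ.+ b) ≡⟨ +-assoc _ _ _ ⟩
    sumF a f + sumF (suc b) (λ i → f (a ℕ.+ i))         ∎
    where open ≡-Reasoning

  sumF-blocks : ∀ q k f → sumF (q ℕ.* k) f ≡ sumF q (λ l → sumF k (λ i → f (l ℕ.* k ℕ.+ i)))
  sumF-blocks zero k f = refl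
  sumF-blocks (suc q) k f = begin
    sumF (k ℕ.+ q ℕ.* k) f                                ≡⟨ cong (λ z → sumF z f) (ℕₚ.+-comm k (q ℕ.* k)) ⟩
    sumF (q ℕ.* k ℕ.+ k) f                                ≡⟨ sumF-split (q ℕ.* k) k f ⟩
    sumF (q ℕ.* k) f + sumF k (λ i → f (q ℕ.* k ℕ.+ i))   ≡⟨ cong (_+ sumF k (λ i → f (q ℕ.* k ℕ.+ i))) (sumF-blocks q k f) ⟩
    sumF (suc q) (λ l → sumF k (λ i → f (l ℕ.* k ℕ.+ i))) ∎
    where open ≡-Reasoning

  sumF-comm : ∀ a b (f : ℕ → ℕ → Carrier) →
              sumF a (λ i → sumF b (f i)) ≡ sumF b (λ j → sumF a (λ i → f i j))
  sumF-comm zero b f = sym (sumF-zero b)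
  sumF-comm (suc a) b f = trans (cong (_+ sumF b (f a)) (sumF-comm a b f)) (sym (sumF-distrib-+ b _ _))

  enum : Fin (2 ℕ.^ m) → Carrier
  enum = Inverse.to enumeration

  enum⁻¹ : Carrier → Fin (2 ℕ.^ m)
  enum⁻¹ = Inverse.from enumeration

  enum-enum⁻¹ : ∀ y → enum (enum⁻¹ y) ≡ y
  enum-enum⁻¹ = Inverse.strictlyInverseˡ enumeration

  enum⁻¹-enum : ∀ i → enum⁻¹ (enum i) ≡ i
  enum⁻¹-enum = Inverse.strictlyInverseʳ enumeration

  enum-injective : ∀ {i j} → enum i ≡ enum j → i ≡ j
  enum-injective {i} {j} eq = trans (sym (enum⁻¹-enum i)) (trans (cong enum⁻¹ eq) (enum⁻¹-enum j))

module Fermat {m : ℕ} (F : GF m) where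
  open Char2Arithmetic F
  open MonoidSum (CommutativeRing.*-commutativeMonoid commutativeRing)
    using () renaming (sum to ∏; sum-cong-≗ to ∏-cong; ∑-distrib-+ to ∏-distrib-*;
                       sum-permute to ∏-permute)

  ∏-≢0 : ∀ n (f : Fin n → Carrier) → (∀ i → ¬ f i ≡ 0#) → ¬ ∏ f ≡ 0#
  ∏-≢0 zero f f≢0 = 1≢0
  ∏-≢0 (suc n) f f≢0 = *-≢0 (f≢0 Fin.zero) (∏-≢0 n (λ i → f (Fin.suc i)) (λ i → f≢0 (Fin.suc i)))

  ∏-const : ∀ n x → ∏ {n} (λ _ → x) ≡ x ^ n
  ∏-const zero x = refl
  ∏-const (suc n) x = cong (x *_) (∏-const n x)

  ∏-single : ∀ n (j : Fin n) (f : Fin n → Carrier) → (∀ i → ¬ i ≡ j → f i ≡ 1#) → ∏ f ≡ f j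
  ∏-single (suc n) Fin.zero f f≡1 = begin
    f Fin.zero * ∏ (λ i → f (Fin.suc i)) ≡⟨ cong (f Fin.zero *_) (∏-cong (λ i → f≡1 (Fin.suc i) λ ())) ⟩
    f Fin.zero * ∏ {n} (λ _ → 1#)        ≡⟨ cong (f Fin.zero *_) (trans (∏-const n 1#) (1^n≡1 n)) ⟩
    f Fin.zero * 1#                      ≡⟨ *-identityʳ _ ⟩
    f Fin.zero                           ∎
    where open ≡-Reasoning
  ∏-single (suc n) (Fin.suc j) f f≡1 =
    trans (cong (_* ∏ (λ i → f (Fin.suc i))) (f≡1 Fin.zero λ ()))
          (trans (*-identityˡ _) (∏-single n j (λ i → f (Fin.suc i)) (λ i i≢j → f≡1 (Fin.suc i) (λ eq → i≢j (Finₚ.suc-injective eq)))))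

  ifZero : Carrier → Carrier → Carrier → Carrier
  ifZero y a b with y ≟ 0#
  ... | yes _ = a
  ... | no _ = b

  ifZero-≢0 : ∀ y → ¬ ifZero y 1# y ≡ 0#
  ifZero-≢0 y with y ≟ 0#
  ... | yes _ = 1≢0
  ... | no y≢0 = y≢0

  -- Multiplication by x permutes the field and h (x y) = g y * h y, so ∏ g = 1; as g * c is
  -- constantly x, x ^ 2^m = ∏ g * ∏ c = ∏ c = x.
  module _ (x : Carrier) (x≢0 : ¬ x ≡ 0#) where
    private
      x⁻¹ : Carrier
      x⁻¹ = proj₁ (inverse x x≢0)
      x*x⁻¹≡1 : x * x⁻¹ ≡ 1#
      x*x⁻¹≡1 = proj₂ (inverse x x≢0)

      h g c : Carrier → Carrier
      h y = ifZero y 1# y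
      g y = ifZero y 1# x
      c y = ifZero y x 1#

      h-* : ∀ y → h (x * y) ≡ g y * h y
      h-* y with y ≟ 0# | (x * y) ≟ 0#
      ... | yes _   | yes _    = sym (*-identityˡ 1#)
      ... | yes y≡0 | no xy≢0  = ⊥-elim (xy≢0 (trans (cong (x *_) y≡0) (zeroʳ x)))
      ... | no y≢0  | yes xy≡0 = ⊥-elim (*-≢0 x≢0 y≢0 xy≡0)
      ... | no _    | no _     = refl

      g*c≡x : ∀ y → g y * c y ≡ x
      g*c≡x y with y ≟ 0#
      ... | yes _ = *-identityˡ x
      ... | no _ = *-identityʳ x

      multiply : Permutation′ (2 ℕ.^ m)
      multiply = permutation (λ i → enum⁻¹ (x * enum i)) (λ i → enum⁻¹ (x⁻¹ * enum i))
        (λ i → trans (cong (λ z → enum⁻¹ (x * z)) (enum-enum⁻¹ _))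
                     (trans (cong enum⁻¹ (x*[x⁻¹*y] (enum i))) (enum⁻¹-enum i)))
        (λ i → trans (cong (λ z → enum⁻¹ (x⁻¹ * z)) (enum-enum⁻¹ _))
                     (trans (cong enum⁻¹ (x⁻¹*[x*y] (enum i))) (enum⁻¹-enum i)))
        where
        x*[x⁻¹*y] : ∀ y → x * (x⁻¹ * y) ≡ y
        x*[x⁻¹*y] y = trans (sym (*-assoc x x⁻¹ y)) (trans (cong (_* y) x*x⁻¹≡1) (*-identityˡ y))
        x⁻¹*[x*y] : ∀ y → x⁻¹ * (x * y) ≡ y
        x⁻¹*[x*y] y = trans (sym (*-assoc x⁻¹ x y)) (trans (cong (_* y) (trans (*-comm x⁻¹ x) x*x⁻¹≡1)) (*-identityˡ y))

      ∏h≡∏g*∏h : ∏ (h ∘′ enum) ≡ ∏ (g ∘′ enum) * ∏ (h ∘′ enum)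
      ∏h≡∏g*∏h = begin
        ∏ (h ∘′ enum)                                  ≡⟨ ∏-permute (h ∘′ enum) multiply ⟩
        ∏ (λ i → h (enum (enum⁻¹ (x * enum i))))       ≡⟨ ∏-cong (λ i → trans (cong h (enum-enum⁻¹ _)) (h-* (enum i))) ⟩
        ∏ (λ i → g (enum i) * h (enum i))              ≡⟨ ∏-distrib-* (g ∘′ enum) (h ∘′ enum) ⟩
        ∏ (g ∘′ enum) * ∏ (h ∘′ enum)                  ∎
        where open ≡-Reasoning

      ∏g≡1 : ∏ (g ∘′ enum) ≡ 1#
      ∏g≡1 = sym (*-cancelˡ (∏-≢0 _ (h ∘′ enum) (λ i → ifZero-≢0 (enum i)))
                   (trans (*-identityʳ _) (trans ∏h≡∏g*∏h (*-comm _ _))))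

      ∏c≡x : ∏ (c ∘′ enum) ≡ x
      ∏c≡x = trans (∏-single _ (enum⁻¹ 0#) (c ∘′ enum) c≡1) c[0]≡x
        where
        c[0]≡x : c (enum (enum⁻¹ 0#)) ≡ x
        c[0]≡x rewrite enum-enum⁻¹ 0# with 0# ≟ 0#
        ... | yes _ = refl
        ... | no 0≢0 = ⊥-elim (0≢0 refl)
        c≡1 : ∀ i → ¬ i ≡ enum⁻¹ 0# → c (enum i) ≡ 1#
        c≡1 i i≢0 with enum i ≟ 0#
        ... | yes eq = ⊥-elim (i≢0 (trans (sym (enum⁻¹-enum i)) (cong enum⁻¹ eq)))
        ... | no _ = refl

    fermat-≢0 : x ^ (2 ℕ.^ m) ≡ x
    fermat-≢0 = begin
      x ^ (2 ℕ.^ m)                        ≡⟨ ∏-const (2 ℕ.^ m) x ⟨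
      ∏ (λ (_ : Fin (2 ℕ.^ m)) → x)        ≡⟨ ∏-cong (λ i → sym (g*c≡x (enum i))) ⟩
      ∏ (λ i → g (enum i) * c (enum i))    ≡⟨ ∏-distrib-* (g ∘′ enum) (c ∘′ enum) ⟩
      ∏ (g ∘′ enum) * ∏ (c ∘′ enum)        ≡⟨ cong₂ _*_ ∏g≡1 ∏c≡x ⟩
      1# * x                               ≡⟨ *-identityˡ x ⟩
      x                                    ∎
      where open ≡-Reasoning

  fermat : ∀ x → x ^ (2 ℕ.^ m) ≡ x
  fermat x with x ≟ 0#
  ... | yes refl = frobenius-0 m
  ... | no x≢0 = fermat-≢0 x x≢0

module Polynomials {m : ℕ} (F : GF m) where
  open Char2Arithmetic F

  Poly : Set
  Poly = List Carrier

  eval : Poly → Carrier → Carrier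
  eval [] x = 0#
  eval (c ∷ cs) x = c + x * eval cs x

  IsZero : Poly → Set
  IsZero = All (_≡ 0#)

  divide : Carrier → Poly → Poly × Carrier
  divide r [] = [] , 0#
  divide r (c ∷ []) = [] , c
  divide r (c ∷ cs@(_ ∷ _)) with divide r cs
  ... | q , ρ = ρ ∷ q , c + r * ρ

  eval-divide : ∀ r p x → eval p x ≡ (x + r) * eval (proj₁ (divide r p)) x + proj₂ (divide r p)
  eval-divide r [] x = sym (trans (+-identityʳ _) (zeroʳ _))
  eval-divide r (c ∷ []) x = trans (cong (c +_) (zeroʳ x)) (trans (+-identityʳ c) (sym (trans (cong (_+ c) (zeroʳ _)) (+-identityˡ c))))
  eval-divide r (c ∷ cs@(_ ∷ _)) x with divide r cs | eval-divide r cs x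
  ... | q , ρ | cs≡ = begin
    c + x * eval cs x                                   ≡⟨ cong (λ z → c + x * z) cs≡ ⟩
    c + x * ((x + r) * Q + ρ)                           ≡⟨ +-identityʳ _ ⟨
    c + x * ((x + r) * Q + ρ) + 0#                      ≡⟨ cong (c + x * ((x + r) * Q + ρ) +_) (x+x≡0 (r * ρ)) ⟨
    c + x * ((x + r) * Q + ρ) + (r * ρ + r * ρ)         ≡⟨ solve 5 (λ c x r Q ρ →
        (c :+ x :* ((x :+ r) :* Q :+ ρ)) :+ (r :* ρ :+ r :* ρ)
          := (x :+ r) :* (ρ :+ x :* Q) :+ (c :+ r :* ρ)) refl c x r Q ρ ⟩
    (x + r) * (ρ + x * Q) + (c + r * ρ)                 ∎
    where
    open ≡-Reasoning
    Q : Carrier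
    Q = eval q x

  divide-isZero : ∀ r p → proj₂ (divide r p) ≡ 0# → IsZero (proj₁ (divide r p)) → IsZero p
  divide-isZero r [] _ _ = []
  divide-isZero r (c ∷ []) c≡0 _ = c≡0 ∷ []
  divide-isZero r (c ∷ cs@(_ ∷ _)) rem≡0 q≡0 with divide r cs | divide-isZero r cs
  ... | q , ρ | cs≡0 with q≡0
  ...   | ρ≡0 ∷ q≡0′ = c≡0 ∷ cs≡0 ρ≡0 q≡0′
    where
    c≡0 : c ≡ 0#
    c≡0 = trans (sym (trans (cong (λ z → c + r * z) ρ≡0) (trans (cong (c +_) (zeroʳ r)) (+-identityʳ c)))) rem≡0

  length-divide : ∀ r c cs → length (proj₁ (divide r (c ∷ cs))) ≡ length cs
  length-divide r c [] = refl
  length-divide r c (c′ ∷ cs) with divide r (c′ ∷ cs) | length-divide r c′ cs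
  ... | q , ρ | len = cong suc len

  root-bound : ∀ n (r : Fin n → Carrier) → (∀ {i j} → r i ≡ r j → i ≡ j) →
               ∀ p → (∀ i → eval p (r i) ≡ 0#) → length p ≤ n → IsZero p
  root-bound n r r-injective [] roots len = []
  root-bound (suc n) r r-injective (c ∷ p) roots (s≤s len) =
    divide-isZero r₀ (c ∷ p) ρ≡0
      (root-bound n (λ i → r (Fin.suc i)) (λ eq → Finₚ.suc-injective (r-injective eq)) q q-roots
        (subst (_≤ n) (sym (length-divide r₀ c p)) len))
    where
    r₀ : Carrier
    r₀ = r Fin.zero
    q : Poly
    q = proj₁ (divide r₀ (c ∷ p))
    ρ : Carrier
    ρ = proj₂ (divide r₀ (c ∷ p))
    ρ≡0 : ρ ≡ 0#
    ρ≡0 = begin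
      ρ                                  ≡⟨ +-identityˡ ρ ⟨
      0# + ρ                             ≡⟨ cong (_+ ρ) (zeroˡ (eval q r₀)) ⟨
      0# * eval q r₀ + ρ                 ≡⟨ cong (λ z → z * eval q r₀ + ρ) (x+x≡0 r₀) ⟨
      (r₀ + r₀) * eval q r₀ + ρ          ≡⟨ eval-divide r₀ (c ∷ p) r₀ ⟨
      eval (c ∷ p) r₀                    ≡⟨ roots Fin.zero ⟩
      0#                                 ∎
      where open ≡-Reasoning
    q-roots : ∀ i → eval q (r (Fin.suc i)) ≡ 0#
    q-roots i with x*y≡0⇒x≡0⊎y≡0 (begin
        (rᵢ + r₀) * eval q rᵢ          ≡⟨ +-identityʳ _ ⟨
        (rᵢ + r₀) * eval q rᵢ + 0#     ≡⟨ cong ((rᵢ + r₀) * eval q rᵢ +_) ρ≡0 ⟨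
        (rᵢ + r₀) * eval q rᵢ + ρ      ≡⟨ eval-divide r₀ (c ∷ p) rᵢ ⟨
        eval (c ∷ p) rᵢ                ≡⟨ roots (Fin.suc i) ⟩
        0#                             ∎)
      where
      open ≡-Reasoning
      rᵢ : Carrier
      rᵢ = r (Fin.suc i)
    ... | inj₁ rᵢ+r₀≡0 with r-injective (+≡0⇒≡ rᵢ+r₀≡0)
    ...   | ()
    q-roots i | inj₂ q[rᵢ]≡0 = q[rᵢ]≡0

  square : Poly → Poly
  square [] = []
  square (c ∷ cs) = c * c ∷ 0# ∷ square cs

  eval-square : ∀ p x → eval (square p) x ≡ eval p x * eval p x
  eval-square [] x = sym (zeroˡ _)
  eval-square (c ∷ cs) x = begin
    c * c + x * (0# + x * eval (square cs) x)   ≡⟨ cong (λ z → c * c + x * z) (+-identityˡ _) ⟩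
    c * c + x * (x * eval (square cs) x)        ≡⟨ cong (λ z → c * c + x * (x * z)) (eval-square cs x) ⟩
    c * c + x * (x * (P * P))                   ≡⟨ +-identityʳ _ ⟨
    c * c + x * (x * (P * P)) + 0#              ≡⟨ cong (c * c + x * (x * (P * P)) +_) (x+x≡0 (c * x * P)) ⟨
    c * c + x * (x * (P * P)) + (c * x * P + c * x * P) ≡⟨ solve 3 (λ c x P →
        c :* c :+ x :* (x :* (P :* P)) :+ (c :* x :* P :+ c :* x :* P)
          := (c :+ x :* P) :* (c :+ x :* P)) refl c x P ⟩
    (c + x * P) * (c + x * P)                   ∎
    where
    open ≡-Reasoning
    P : Carrier
    P = eval cs x

  length-square : ∀ p → length (square p) ≡ 2 ℕ.* length p
  length-square [] = refl
  length-square (c ∷ cs) = trans (cong (suc ∘′ suc) (length-square cs)) (sym (ℕₚ.*-suc 2 (length cs)))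

  X+square : Poly → Poly
  X+square [] = 0# ∷ 1# ∷ []
  X+square (c ∷ cs) = c * c ∷ 1# ∷ square cs

  eval-X+square : ∀ p x → eval (X+square p) x ≡ x + eval p x * eval p x
  eval-X+square [] x = begin
    0# + x * (1# + x * 0#)  ≡⟨ +-identityˡ _ ⟩
    x * (1# + x * 0#)       ≡⟨ cong (λ z → x * (1# + z)) (zeroʳ x) ⟩
    x * (1# + 0#)           ≡⟨ cong (x *_) (+-identityʳ 1#) ⟩
    x * 1#                  ≡⟨ *-identityʳ x ⟩
    x                       ≡⟨ +-identityʳ x ⟨
    x + 0#                  ≡⟨ cong (x +_) (zeroˡ 0#) ⟨
    x + 0# * 0#             ∎
    where open ≡-Reasoning
  eval-X+square (c ∷ cs) x = begin
    c * c + x * (1# + R)              ≡⟨ solve 4 (λ c x o R → c :* c :+ x :* (o :+ R) := x :* o :+ (c :* c :+ x :* R))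
                                                  refl c x 1# R ⟩
    x * 1# + (c * c + x * R)          ≡⟨ cong₂ _+_ (*-identityʳ x) (cong (λ z → c * c + x * z) (sym (+-identityˡ R))) ⟩
    x + eval (square (c ∷ cs)) x      ≡⟨ cong (x +_) (eval-square (c ∷ cs) x) ⟩
    x + eval (c ∷ cs) x * eval (c ∷ cs) x ∎
    where
    open ≡-Reasoning
    R : Carrier
    R = x * eval (square cs) x

  X+square-nonzero : ∀ p → ¬ IsZero (X+square p)
  X+square-nonzero [] (_ ∷ 1≡0 ∷ _) = 1≢0 1≡0
  X+square-nonzero (_ ∷ _) (_ ∷ 1≡0 ∷ _) = 1≢0 1≡0

  length-X+square : ∀ p → 1 ≤ length p → length (X+square p) ≡ 2 ℕ.* length p
  length-X+square (c ∷ cs) _ = length-square (c ∷ cs)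

  tracePoly : ℕ → Poly
  tracePoly zero = []
  tracePoly (suc j) = X+square (tracePoly j)

  eval-tracePoly : ∀ j x → eval (tracePoly j) x ≡ sumF j (λ i → x ^ (2 ℕ.^ i))
  eval-tracePoly zero x = refl
  eval-tracePoly (suc j) x = begin
    eval (X+square (tracePoly j)) x        ≡⟨ eval-X+square (tracePoly j) x ⟩
    x + T * T                              ≡⟨ cong (λ z → x + T * z) (*-identityʳ T) ⟨
    x + T ^ 2                              ≡⟨ cong (λ z → x + z ^ (2 ℕ.^ 1)) (eval-tracePoly j x) ⟩
    x + sumF j f ^ (2 ℕ.^ 1)               ≡⟨ cong (x +_) (frobenius-sumF j f 1) ⟩
    x + sumF j (λ i → f i ^ (2 ℕ.^ 1))     ≡⟨ cong₂ _+_ (^-identityʳ x) (sumF-cong j (λ i → sym (frobenius-∘ x i 1))) ⟨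
    x ^ 1 + sumF j (λ i → x ^ (2 ℕ.^ (i ℕ.+ 1))) ≡⟨ cong (x ^ 1 +_) (sumF-cong j (λ i → cong (λ z → x ^ (2 ℕ.^ z)) (ℕₚ.+-comm i 1))) ⟩
    f 0 + sumF j (λ i → f (suc i))         ≡⟨ sumF-suc j f ⟨
    sumF (suc j) f                         ∎
    where
    open ≡-Reasoning
    T : Carrier
    T = eval (tracePoly j) x
    f : ℕ → Carrier
    f i = x ^ (2 ℕ.^ i)

  length-tracePoly : ∀ j → length (tracePoly (suc j)) ≡ 2 ℕ.^ suc j
  length-tracePoly zero = refl
  length-tracePoly (suc j) =
    trans (length-X+square (tracePoly (suc j)) (subst (1 ≤_) (sym (length-tracePoly j)) (ℕₚ.m^n>0 2 (suc j))))
          (cong (2 ℕ.*_) (length-tracePoly j))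

Tr-nonzero : ∀ {n} (F : GF (suc n)) → Σ (Field.Carrier F) λ x → ¬ Field.Tr F x ≡ Field.0# F
Tr-nonzero {n} F with Finₚ.¬∀⟶∃¬ _ _ (λ i → Field.Tr F (enum i) ≟ 0#) not-identically-0
  where
  open Char2Arithmetic F
  open Polynomials F
  not-identically-0 : ¬ (∀ i → Tr (enum i) ≡ 0#)
  not-identically-0 Tr≡0 = X+square-nonzero (tracePoly n)
    (root-bound _ enum enum-injective (tracePoly (suc n))
      (λ i → trans (eval-tracePoly (suc n) (enum i)) (Tr≡0 i)) (ℕₚ.≤-reflexive (length-tracePoly n)))
... | i , Trᵢ≢0 = Inverse.to (GF.enumeration F) i , Trᵢ≢0

module Subfield {m : ℕ} (F : GF m) (k : ℕ) (k∣m : k ∣ m) where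
  open Char2Arithmetic F
  open Fermat F using (fermat)
  open _∣_ k∣m using (quotient; equality)

  InSub-0 : InSub k 0#
  InSub-0 = frobenius-0 k

  InSub-1 : InSub k 1#
  InSub-1 = 1^n≡1 (2 ℕ.^ k)

  InSub-+ : ∀ {a b} → InSub k a → InSub k b → InSub k (a + b)
  InSub-+ {a} {b} a∈ b∈ = trans (frobenius-+ a b k) (cong₂ _+_ a∈ b∈)

  InSub-* : ∀ {a b} → InSub k a → InSub k b → InSub k (a * b)
  InSub-* {a} {b} a∈ b∈ = trans (^-distribʳ-* a b (2 ℕ.^ k)) (cong₂ _*_ a∈ b∈)

  InSub-⁻¹ : ∀ {a b} → InSub k a → ¬ a ≡ 0# → a * b ≡ 1# → InSub k b
  InSub-⁻¹ {a} {b} a∈ a≢0 ab≡1 = *-cancelˡ a≢0 (begin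
    a * b ^ (2 ℕ.^ k)                ≡⟨ cong (_* b ^ (2 ℕ.^ k)) a∈ ⟨
    a ^ (2 ℕ.^ k) * b ^ (2 ℕ.^ k)    ≡⟨ ^-distribʳ-* a b (2 ℕ.^ k) ⟨
    (a * b) ^ (2 ℕ.^ k)              ≡⟨ cong (_^ (2 ℕ.^ k)) ab≡1 ⟩
    1# ^ (2 ℕ.^ k)                   ≡⟨ 1^n≡1 (2 ℕ.^ k) ⟩
    1#                               ≡⟨ ab≡1 ⟨
    a * b                            ∎)
    where open ≡-Reasoning

  InSub-sumF : ∀ n f → (∀ i → InSub k (f i)) → InSub k (sumF n f)
  InSub-sumF zero f f∈ = InSub-0
  InSub-sumF (suc n) f f∈ = InSub-+ (InSub-sumF n f f∈) (f∈ n)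

  InSub-frobenius : ∀ {a} → InSub k a → ∀ l i → a ^ (2 ℕ.^ (l ℕ.* k ℕ.+ i)) ≡ a ^ (2 ℕ.^ i)
  InSub-frobenius {a} a∈ l i = trans (sym (frobenius-∘ a (l ℕ.* k) i)) (cong (_^ (2 ℕ.^ i)) (fixed l))
    where
    fixed : ∀ l → a ^ (2 ℕ.^ (l ℕ.* k)) ≡ a
    fixed zero = ^-identityʳ a
    fixed (suc l) = trans (sym (frobenius-∘ a k (l ℕ.* k))) (trans (cong (_^ (2 ℕ.^ (l ℕ.* k))) a∈) (fixed l))

  RelTr-InSub : ∀ s → InSub k (RelTr k k∣m s)
  RelTr-InSub s = begin
    sumF quotient g ^ (2 ℕ.^ k)                ≡⟨ frobenius-sumF quotient g k ⟩
    sumF quotient (λ j → g j ^ (2 ℕ.^ k))      ≡⟨ sumF-cong quotient g[j]^2^k≡g[j+1] ⟩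
    sumF quotient (λ j → g (suc j))            ≡⟨ sumF-rotate quotient g g[q]≡g[0] ⟩
    sumF quotient g                            ∎
    where
    open ≡-Reasoning
    g : ℕ → Carrier
    g j = s ^ (2 ℕ.^ (k ℕ.* j))
    g[j]^2^k≡g[j+1] : ∀ j → g j ^ (2 ℕ.^ k) ≡ g (suc j)
    g[j]^2^k≡g[j+1] j = trans (frobenius-∘ s (k ℕ.* j) k)
      (cong (λ z → s ^ (2 ℕ.^ z)) (trans (ℕₚ.+-comm (k ℕ.* j) k) (sym (ℕₚ.*-suc k j))))
    g[q]≡g[0] : g quotient ≡ g 0
    g[q]≡g[0] = begin
      s ^ (2 ℕ.^ (k ℕ.* quotient))   ≡⟨ cong (λ z → s ^ (2 ℕ.^ z)) (trans (ℕₚ.*-comm k quotient) (sym equality)) ⟩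
      s ^ (2 ℕ.^ m)                  ≡⟨ fermat s ⟩
      s                              ≡⟨ ^-identityʳ s ⟨
      s ^ 1                          ≡⟨ cong (λ z → s ^ (2 ℕ.^ z)) (ℕₚ.*-zeroʳ k) ⟨
      g 0                            ∎

  RelTr-0 : RelTr k k∣m 0# ≡ 0#
  RelTr-0 = trans (sumF-cong quotient (λ j → frobenius-0 (k ℕ.* j))) (sumF-zero quotient)

  Trₖ : Carrier → Carrier
  Trₖ γ = sumF k (λ i → γ ^ (2 ℕ.^ i))

  Trₖ-0 : Trₖ 0# ≡ 0#
  Trₖ-0 = trans (sumF-cong k frobenius-0) (sumF-zero k)

  Trₖ-+ : ∀ a b → Trₖ (a + b) ≡ Trₖ a + Trₖ b
  Trₖ-+ a b = trans (sumF-cong k (frobenius-+ a b)) (sumF-distrib-+ k _ _)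

  Trₖ-idempotent : ∀ {z} → InSub k z → Trₖ z * Trₖ z ≡ Trₖ z
  Trₖ-idempotent {z} z∈ = begin
    Trₖ z * Trₖ z                        ≡⟨ cong (Trₖ z *_) (*-identityʳ (Trₖ z)) ⟨
    Trₖ z ^ (2 ℕ.^ 1)                    ≡⟨ frobenius-sumF k g 1 ⟩
    sumF k (λ i → g i ^ (2 ℕ.^ 1))       ≡⟨ sumF-cong k (λ i → trans (frobenius-∘ z i 1)
                                              (cong (λ j → z ^ (2 ℕ.^ j)) (ℕₚ.+-comm i 1))) ⟩
    sumF k (λ i → g (suc i))             ≡⟨ sumF-rotate k g (trans z∈ (sym (^-identityʳ z))) ⟩
    Trₖ z                                ∎
    where
    open ≡-Reasoning
    g : ℕ → Carrier
    g i = z ^ (2 ℕ.^ i)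

  idempotent⇒0⊎1 : ∀ {t} → t * t ≡ t → t ≡ 0# ⊎ t ≡ 1#
  idempotent⇒0⊎1 {t} tt≡t with x*y≡0⇒x≡0⊎y≡0 (trans (distribˡ t t 1#) (trans (cong₂ _+_ tt≡t (*-identityʳ t)) (x+x≡0 t)))
  ... | inj₁ t≡0 = inj₁ t≡0
  ... | inj₂ t+1≡0 = inj₂ (+≡0⇒≡ t+1≡0)

  Trₖ-0⊎1 : ∀ {z} → InSub k z → Trₖ z ≡ 0# ⊎ Trₖ z ≡ 1#
  Trₖ-0⊎1 z∈ = idempotent⇒0⊎1 (Trₖ-idempotent z∈)

  Tr-RelTr : ∀ {a} → InSub k a → ∀ s → Tr (a * s) ≡ Trₖ (a * RelTr k k∣m s)
  Tr-RelTr {a} a∈ s = begin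
    sumF m f                                                        ≡⟨ cong (λ z → sumF z f) equality ⟩
    sumF (quotient ℕ.* k) f                                         ≡⟨ sumF-blocks quotient k f ⟩
    sumF quotient (λ l → sumF k (λ i → f (l ℕ.* k ℕ.+ i)))          ≡⟨ sumF-cong quotient (λ l → sumF-cong k (block l)) ⟩
    sumF quotient (λ l → sumF k (λ i → a ^ (2 ℕ.^ i) * g l ^ (2 ℕ.^ i))) ≡⟨ sumF-comm quotient k _ ⟩
    sumF k (λ i → sumF quotient (λ l → a ^ (2 ℕ.^ i) * g l ^ (2 ℕ.^ i))) ≡⟨ sumF-cong k (λ i → *-distribˡ-sumF quotient _ _) ⟨
    sumF k (λ i → a ^ (2 ℕ.^ i) * sumF quotient (λ l → g l ^ (2 ℕ.^ i))) ≡⟨ sumF-cong k (λ i → cong (a ^ (2 ℕ.^ i) *_) (frobenius-sumF quotient g i)) ⟨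
    sumF k (λ i → a ^ (2 ℕ.^ i) * RelTr k k∣m s ^ (2 ℕ.^ i))        ≡⟨ sumF-cong k (λ i → ^-distribʳ-* a (RelTr k k∣m s) (2 ℕ.^ i)) ⟨
    Trₖ (a * RelTr k k∣m s)                                         ∎
    where
    open ≡-Reasoning
    f : ℕ → Carrier
    f j = (a * s) ^ (2 ℕ.^ j)
    g : ℕ → Carrier
    g l = s ^ (2 ℕ.^ (k ℕ.* l))
    block : ∀ l i → f (l ℕ.* k ℕ.+ i) ≡ a ^ (2 ℕ.^ i) * g l ^ (2 ℕ.^ i)
    block l i = trans (^-distribʳ-* a s (2 ℕ.^ (l ℕ.* k ℕ.+ i))) (cong₂ _*_ (InSub-frobenius a∈ l i)
      (trans (cong (λ z → s ^ (2 ℕ.^ (z ℕ.+ i))) (ℕₚ.*-comm l k)) (sym (frobenius-∘ s (k ℕ.* l) i))))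

module Combinations {m : ℕ} (F : GF m) (k : ℕ) where
  open Char2Arithmetic F

  select : (Fin k → Bool) → (Fin k → Carrier) → ℕ → Carrier
  select b β i with i ℕ.<? k
  ... | yes i<k = if b (fromℕ< i<k) then β (fromℕ< i<k) else 0#
  ... | no _ = 0#

  module _ (b : Fin k → Bool) (β : Fin k → Carrier) where
    -- The summand of comb is a where-bound helper that cannot be named; the underscore is
    -- solved from its use in comb≡sumF-select, which the mutual block checks first.
    mutual
      comb≡sumF-select : comb k b β ≡ sumF k (select b β)
      comb≡sumF-select = sumF-cong k summand≗select

      summand≗select : ∀ i → _ ≡ select b β i
      summand≗select i with i ℕ.<? k
      ... | yes _ = refl
      ... | no _ = refl

  select-cases : ∀ b β i → select b β i ≡ 0# ⊎ Σ (Fin k) λ j → select b β i ≡ β j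
  select-cases b β i with i ℕ.<? k
  ... | no _ = inj₁ refl
  ... | yes i<k with b (fromℕ< i<k)
  ...   | true = inj₂ (fromℕ< i<k , refl)
  ...   | false = inj₁ refl

  select-xor : ∀ b b′ β i → select b β i + select b′ β i ≡ select (λ j → b j xor b′ j) β i
  select-xor b b′ β i with i ℕ.<? k
  ... | no _ = +-identityʳ 0#
  ... | yes i<k with b (fromℕ< i<k) | b′ (fromℕ< i<k)
  ...   | true  | true  = x+x≡0 _
  ...   | true  | false = +-identityʳ _
  ...   | false | true  = +-identityˡ _
  ...   | false | false = +-identityʳ 0#

  select-square : ∀ b β i → select b β i * select b β i ≡ select b (λ j → β j * β j) i
  select-square b β i with i ℕ.<? k
  ... | no _ = zeroʳ 0#
  ... | yes i<k with b (fromℕ< i<k)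
  ...   | true = refl
  ...   | false = zeroʳ 0#

  comb-closed : (P : Carrier → Set) → P 0# → (∀ {a b} → P a → P b → P (a + b)) →
                ∀ β → (∀ j → P (β j)) → ∀ b → P (comb k b β)
  comb-closed P P0 P+ β Pβ b = subst P (sym (comb≡sumF-select b β)) (sumF-closed k (select-closed))
    where
    select-closed : ∀ i → P (select b β i)
    select-closed i with select-cases b β i
    ... | inj₁ eq = subst P (sym eq) P0
    ... | inj₂ (j , eq) = subst P (sym eq) (Pβ j)
    sumF-closed : ∀ n {f} → (∀ i → P (f i)) → P (sumF n f)
    sumF-closed zero Pf = P0
    sumF-closed (suc n) Pf = P+ (sumF-closed n Pf) (Pf n)

  comb-xor : ∀ b b′ β → comb k b β + comb k b′ β ≡ comb k (λ j → b j xor b′ j) β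
  comb-xor b b′ β = begin
    comb k b β + comb k b′ β                           ≡⟨ cong₂ _+_ (comb≡sumF-select b β) (comb≡sumF-select b′ β) ⟩
    sumF k (select b β) + sumF k (select b′ β)         ≡⟨ sumF-distrib-+ k _ _ ⟨
    sumF k (λ i → select b β i + select b′ β i)        ≡⟨ sumF-cong k (select-xor b b′ β) ⟩
    sumF k (select (λ j → b j xor b′ j) β)             ≡⟨ comb≡sumF-select _ β ⟨
    comb k (λ j → b j xor b′ j) β                      ∎
    where open ≡-Reasoning

  comb-square : ∀ b β → comb k b β * comb k b β ≡ comb k b (λ j → β j * β j)
  comb-square b β = begin
    comb k b β * comb k b β                          ≡⟨ cong (λ w → w * w) (comb≡sumF-select b β) ⟩
    S * S                                            ≡⟨ cong (S *_) (*-identityʳ S) ⟨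
    S ^ (2 ℕ.^ 1)                                    ≡⟨ frobenius-sumF k (select b β) 1 ⟩
    sumF k (λ i → select b β i ^ (2 ℕ.^ 1))          ≡⟨ sumF-cong k (λ i → trans (cong (select b β i *_) (*-identityʳ _))
                                                          (select-square b β i)) ⟩
    sumF k (select b (λ j → β j * β j))              ≡⟨ comb≡sumF-select b _ ⟨
    comb k b (λ j → β j * β j)                       ∎
    where
    open ≡-Reasoning
    S : Carrier
    S = sumF k (select b β)

  comb-injective : ∀ {β} → IsBasis k β → ∀ {b b′} → comb k b β ≡ comb k b′ β → ∀ i → b i ≡ b′ i
  comb-injective {β} (_ , independent , _) {b} {b′} eq i =
    xor≡false (b i) (b′ i) (independent _ (trans (sym (comb-xor b b′ β)) (≡⇒+≡0 eq)) i)
    where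
    xor≡false : ∀ x y → x xor y ≡ false → x ≡ y
    xor≡false false false _ = refl
    xor≡false true true _ = refl

module BinaryWeights {m : ℕ} (F : GF m) where
  open Field F using (weighted)

  weighted-cong : ∀ j {t t′ : Fin j → ℕ} → (∀ i → t i ≡ t′ i) → weighted j t ≡ weighted j t′
  weighted-cong zero t≗t′ = refl
  weighted-cong (suc j) t≗t′ = cong₂ (λ a b → a ℕ.+ 2 ℕ.* b) (t≗t′ Fin.zero) (weighted-cong j (λ i → t≗t′ (Fin.suc i)))

  weighted-zero : ∀ j → weighted j (λ _ → 0) ≡ 0
  weighted-zero zero = refl
  weighted-zero (suc j) = cong (2 ℕ.*_) (weighted-zero j)

  weighted<2^ : ∀ j (t : Fin j → ℕ) → (∀ i → t i ≤ 1) → weighted j t < 2 ℕ.^ j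
  weighted<2^ zero t t≤1 = s≤s z≤n
  weighted<2^ (suc j) t t≤1 = begin-strict
    t Fin.zero ℕ.+ 2 ℕ.* w   <⟨ s≤s (ℕₚ.+-monoˡ-≤ (2 ℕ.* w) (t≤1 Fin.zero)) ⟩
    2 ℕ.+ 2 ℕ.* w            ≡⟨ ℕₚ.*-suc 2 w ⟨
    2 ℕ.* suc w              ≤⟨ ℕₚ.*-monoʳ-≤ 2 (weighted<2^ j (t ∘′ Fin.suc) (λ i → t≤1 (Fin.suc i))) ⟩
    2 ℕ.^ suc j              ∎
    where
    open ℕₚ.≤-Reasoning
    w : ℕ
    w = weighted j (t ∘′ Fin.suc)

  weighted-injective : ∀ j {t t′ : Fin j → ℕ} → (∀ i → t i ≤ 1) → (∀ i → t′ i ≤ 1) →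
                       weighted j t ≡ weighted j t′ → ∀ i → t i ≡ t′ i
  weighted-injective (suc j) {t} {t′} t≤1 t′≤1 eq = pointwise
    where
    a : ℕ
    a = t Fin.zero
    a′ : ℕ
    a′ = t′ Fin.zero
    w : ℕ
    w = weighted j (t ∘′ Fin.suc)
    w′ : ℕ
    w′ = weighted j (t′ ∘′ Fin.suc)
    lowest : ∀ a b → a ≤ 1 → (a ℕ.+ 2 ℕ.* b) ℕ.% 2 ≡ a
    lowest a b a≤1 = trans (cong (λ z → (a ℕ.+ z) ℕ.% 2) (ℕₚ.*-comm 2 b))
                           (trans (ℕ÷.[m+kn]%n≡m%n a b 2) (ℕ÷.m<n⇒m%n≡m (s≤s a≤1)))
    a≡a′ : a ≡ a′
    a≡a′ = trans (sym (lowest a w (t≤1 Fin.zero))) (trans (cong (ℕ._% 2) eq) (lowest a′ w′ (t′≤1 Fin.zero)))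
    w≡w′ : w ≡ w′
    w≡w′ = ℕₚ.*-cancelˡ-≡ w w′ 2 (ℕₚ.+-cancelˡ-≡ a _ _ (trans eq (cong (ℕ._+ 2 ℕ.* w′) (sym a≡a′))))
    pointwise : ∀ i → t i ≡ t′ i
    pointwise Fin.zero = a≡a′
    pointwise (Fin.suc i) = weighted-injective j (λ i → t≤1 (Fin.suc i)) (λ i → t′≤1 (Fin.suc i)) w≡w′ i

  odd : ℕ → Bool
  odd zero = false
  odd (suc zero) = true
  odd (suc (suc x)) = odd x

  fromBool : Bool → ℕ
  fromBool b = if b then 1 else 0

  fromBool-odd+2*⌊/2⌋ : ∀ x → fromBool (odd x) ℕ.+ 2 ℕ.* ⌊ x /2⌋ ≡ x
  fromBool-odd+2*⌊/2⌋ zero = refl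
  fromBool-odd+2*⌊/2⌋ (suc zero) = refl
  fromBool-odd+2*⌊/2⌋ (suc (suc x)) = begin
    fromBool (odd x) ℕ.+ 2 ℕ.* suc ⌊ x /2⌋        ≡⟨ cong (fromBool (odd x) ℕ.+_) (ℕₚ.*-suc 2 ⌊ x /2⌋) ⟩
    fromBool (odd x) ℕ.+ (2 ℕ.+ 2 ℕ.* ⌊ x /2⌋)    ≡⟨ ℕₚ.+-comm (fromBool (odd x)) _ ⟩
    2 ℕ.+ 2 ℕ.* ⌊ x /2⌋ ℕ.+ fromBool (odd x)      ≡⟨ cong (2 ℕ.+_) (ℕₚ.+-comm (2 ℕ.* ⌊ x /2⌋) _) ⟩
    2 ℕ.+ (fromBool (odd x) ℕ.+ 2 ℕ.* ⌊ x /2⌋)    ≡⟨ cong (2 ℕ.+_) (fromBool-odd+2*⌊/2⌋ x) ⟩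
    suc (suc x)                                   ∎
    where open ≡-Reasoning

  digits : ∀ j → ℕ → Fin j → Bool
  digits (suc j) x Fin.zero = odd x
  digits (suc j) x (Fin.suc i) = digits j ⌊ x /2⌋ i

  weighted-digits : ∀ j x → x < 2 ℕ.^ j → weighted j (fromBool ∘′ digits j x) ≡ x
  weighted-digits zero zero _ = refl
  weighted-digits zero (suc x) (s≤s ())
  weighted-digits (suc j) x x<2^j+1 =
    trans (cong (λ z → fromBool (odd x) ℕ.+ 2 ℕ.* z) (weighted-digits j ⌊ x /2⌋ ⌊x/2⌋<2^j))
          (fromBool-odd+2*⌊/2⌋ x)
    where
    ⌊x/2⌋<2^j : ⌊ x /2⌋ < 2 ℕ.^ j
    ⌊x/2⌋<2^j = ℕₚ.*-cancelˡ-< 2 ⌊ x /2⌋ (2 ℕ.^ j)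
      (ℕₚ.≤-<-trans (ℕₚ.≤-trans (ℕₚ.m≤n+m (2 ℕ.* ⌊ x /2⌋) (fromBool (odd x))) (ℕₚ.≤-reflexive (fromBool-odd+2*⌊/2⌋ x))) x<2^j+1)

-- If y is missed, punching y out of the codomain gives an injection Fin (suc n) → Fin n,
-- contradicting the pigeonhole principle.
Fin-injective⇒surjective : ∀ {n} (f : Fin n → Fin n) → (∀ {a b} → f a ≡ f b → a ≡ b) →
                           ∀ y → Σ (Fin n) λ x → f x ≡ y
Fin-injective⇒surjective f f-injective y with Finₚ.any? (λ x → f x Finₚ.≟ y)
... | yes hit = hit
Fin-injective⇒surjective {suc n} f f-injective y | no miss with Finₚ.pigeonhole (ℕₚ.n<1+n n) punched
  where
  punched : Fin (suc n) → Fin n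
  punched x = Fin.punchOut {i = y} {j = f x} (λ eq → miss (x , sym eq))
... | a , b , a<b , eq =
  ⊥-elim (Finₚ.<⇒≢ a<b (f-injective (Finₚ.punchOut-injective (λ e → miss (a , sym e)) (λ e → miss (b , sym e)) eq)))

module Encoding {n : ℕ} (F : GF (suc n)) (k : ℕ) (k∣m : k ∣ suc n) where
  open Char2Arithmetic F
  open Fermat F using (fermat)
  open Subfield F k k∣m
  open Combinations F k
  open BinaryWeights F

  Trₖ-nondegenerate : ∀ {δ} → InSub k δ → (∀ t → InSub k t → Trₖ (t * δ) ≡ 0#) → δ ≡ 0#
  Trₖ-nondegenerate {δ} δ∈ δ⊥ with δ ≟ 0#
  ... | yes δ≡0 = δ≡0
  ... | no δ≢0 = ⊥-elim (Trₖ[u]≢0 (begin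
    Trₖ u                 ≡⟨ cong Trₖ (trans (cong (u *_) δ⁻¹*δ≡1) (*-identityʳ u)) ⟨
    Trₖ (u * (δ⁻¹ * δ))   ≡⟨ cong Trₖ (*-assoc u δ⁻¹ δ) ⟨
    Trₖ (u * δ⁻¹ * δ)     ≡⟨ δ⊥ (u * δ⁻¹) (InSub-* (RelTr-InSub x) (InSub-⁻¹ δ∈ δ≢0 (proj₂ (inverse δ δ≢0)))) ⟩
    0#                    ∎))
    where
    open ≡-Reasoning
    x : Carrier
    x = proj₁ (Tr-nonzero F)
    u : Carrier
    u = RelTr k k∣m x
    Trₖ[u]≢0 : ¬ Trₖ u ≡ 0#
    Trₖ[u]≢0 Trₖ[u]≡0 = proj₂ (Tr-nonzero F)
      (trans (cong Tr (sym (*-identityˡ x))) (trans (Tr-RelTr InSub-1 x) (trans (cong Trₖ (*-identityˡ u)) Trₖ[u]≡0)))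
    δ⁻¹ : Carrier
    δ⁻¹ = proj₁ (inverse δ δ≢0)
    δ⁻¹*δ≡1 : δ⁻¹ * δ ≡ 1#
    δ⁻¹*δ≡1 = trans (*-comm δ⁻¹ δ) (proj₂ (inverse δ δ≢0))

  √ : Carrier → Carrier
  √ y = y ^ (2 ℕ.^ n)

  √-square : ∀ y → √ y * √ y ≡ y
  √-square y = begin
    √ y * √ y                ≡⟨ cong (√ y *_) (*-identityʳ (√ y)) ⟨
    √ y ^ (2 ℕ.^ 1)          ≡⟨ frobenius-∘ y n 1 ⟩
    y ^ (2 ℕ.^ (n ℕ.+ 1))    ≡⟨ cong (λ j → y ^ (2 ℕ.^ j)) (ℕₚ.+-comm n 1) ⟩
    y ^ (2 ℕ.^ suc n)        ≡⟨ fermat y ⟩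
    y                        ∎
    where open ≡-Reasoning

  InSub-√ : ∀ {y} → InSub k y → InSub k (√ y)
  InSub-√ {y} y∈ = begin
    √ y ^ (2 ℕ.^ k)          ≡⟨ frobenius-∘ y n k ⟩
    y ^ (2 ℕ.^ (n ℕ.+ k))    ≡⟨ cong (λ j → y ^ (2 ℕ.^ j)) (ℕₚ.+-comm n k) ⟩
    y ^ (2 ℕ.^ (k ℕ.+ n))    ≡⟨ frobenius-∘ y k n ⟨
    (y ^ (2 ℕ.^ k)) ^ (2 ℕ.^ n) ≡⟨ cong √ y∈ ⟩
    √ y                      ∎
    where open ≡-Reasoning

  squares-basis : ∀ {α} → IsBasis k α → IsBasis k (λ j → α j * α j)
  squares-basis {α} (α∈ , independent , spanning) =
    (λ i → InSub-* (α∈ i) (α∈ i)) , independent² , spanning²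
    where
    independent² : ∀ b → comb k b (λ j → α j * α j) ≡ 0# → ∀ i → b i ≡ false
    independent² b eq = independent b (square≡0 (trans (comb-square b α) eq))
      where
      square≡0 : ∀ {a} → a * a ≡ 0# → a ≡ 0#
      square≡0 aa≡0 with x*y≡0⇒x≡0⊎y≡0 aa≡0
      ... | inj₁ a≡0 = a≡0
      ... | inj₂ a≡0 = a≡0
    spanning² : ∀ y → InSub k y → Σ (Fin k → Bool) λ b → comb k b (λ j → α j * α j) ≡ y
    spanning² y y∈ with spanning (√ y) (InSub-√ y∈)
    ... | b , comb≡√y = b , trans (sym (comb-square b α)) (trans (cong (λ w → w * w) comb≡√y) (√-square y))

  bit≤1 : ∀ a → bit a ≤ 1
  bit≤1 a with a ≟ 0#
  ... | yes _ = z≤n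
  ... | no _ = s≤s z≤n

  bit-0 : bit 0# ≡ 0
  bit-0 with 0# ≟ 0#
  ... | yes _ = refl
  ... | no 0≢0 = ⊥-elim (0≢0 refl)

  bit-injective : ∀ {a b} → a ≡ 0# ⊎ a ≡ 1# → b ≡ 0# ⊎ b ≡ 1# → bit a ≡ bit b → a ≡ b
  bit-injective {a} {b} a∈𝔽₂ b∈𝔽₂ eq with a ≟ 0# | b ≟ 0# | eq
  ... | yes a≡0 | yes b≡0 | _ = trans a≡0 (sym b≡0)
  ... | no a≢0  | no b≢0  | _ = trans (≡1 a∈𝔽₂ a≢0) (sym (≡1 b∈𝔽₂ b≢0))
    where
    ≡1 : ∀ {z} → z ≡ 0# ⊎ z ≡ 1# → ¬ z ≡ 0# → z ≡ 1#
    ≡1 (inj₁ z≡0) z≢0 = ⊥-elim (z≢0 z≡0)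
    ≡1 (inj₂ z≡1) _ = z≡1

  module Weight {β : Fin k → Carrier} (β-basis : IsBasis k β) where
    private
      β∈ : ∀ i → InSub k (β i)
      β∈ = proj₁ β-basis
      spanning : ∀ y → InSub k y → Σ (Fin k → Bool) λ b → comb k b β ≡ y
      spanning = proj₂ (proj₂ β-basis)

    InSub-comb : ∀ b → InSub k (comb k b β)
    InSub-comb = comb-closed (InSub k) InSub-0 InSub-+ β β∈

    W : Carrier → ℕ
    W γ = weighted k (λ i → bit (Trₖ (β i * γ)))

    W<2^k : ∀ γ → W γ < 2 ℕ.^ k
    W<2^k γ = weighted<2^ k _ (λ i → bit≤1 _)

    W-0 : W 0# ≡ 0
    W-0 = trans (weighted-cong k (λ i → trans (cong bit (trans (cong Trₖ (zeroʳ (β i))) Trₖ-0)) bit-0)) (weighted-zero k)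

    W-injective : ∀ {γ γ′} → InSub k γ → InSub k γ′ → W γ ≡ W γ′ → γ ≡ γ′
    W-injective {γ} {γ′} γ∈ γ′∈ eq = +≡0⇒≡ (Trₖ-nondegenerate (InSub-+ γ∈ γ′∈) (λ t t∈ → spanned t (spanning t t∈)))
      where
      δ : Carrier
      δ = γ + γ′
      Trₖ≡ : ∀ i → Trₖ (β i * γ) ≡ Trₖ (β i * γ′)
      Trₖ≡ i = bit-injective (Trₖ-0⊎1 (InSub-* (β∈ i) γ∈)) (Trₖ-0⊎1 (InSub-* (β∈ i) γ′∈))
                 (weighted-injective k (λ _ → bit≤1 _) (λ _ → bit≤1 _) eq i)
      Trₖ[_*δ]≡0 : Carrier → Set
      Trₖ[ t *δ]≡0 = Trₖ (t * δ) ≡ 0#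
      spanned : ∀ t → Σ (Fin k → Bool) (λ b → comb k b β ≡ t) → Trₖ[ t *δ]≡0
      spanned t (b , comb≡t) = subst Trₖ[_*δ]≡0 comb≡t (comb-closed Trₖ[_*δ]≡0
        (trans (cong Trₖ (zeroˡ δ)) Trₖ-0)
        (λ {a} {b} a⊥ b⊥ → trans (cong Trₖ (distribʳ δ a b)) (trans (Trₖ-+ _ _) (trans (cong₂ _+_ a⊥ b⊥) (+-identityʳ 0#))))
        β (λ j → trans (cong Trₖ (distribˡ (β j) γ γ′)) (trans (Trₖ-+ _ _) (≡⇒+≡0 (Trₖ≡ j))))
        b)

    W-surjective : ∀ (i : Fin (2 ℕ.^ k)) → Σ Carrier λ γ → InSub k γ × W γ ≡ toℕ i
    W-surjective i with Fin-injective⇒surjective W∘element W∘element-injective i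
      where
      element : Fin (2 ℕ.^ k) → Carrier
      element i = comb k (digits k (toℕ i)) β
      W∘element : Fin (2 ℕ.^ k) → Fin (2 ℕ.^ k)
      W∘element i = fromℕ< (W<2^k (element i))
      W∘element-injective : ∀ {i j} → W∘element i ≡ W∘element j → i ≡ j
      W∘element-injective {i} {j} eq = Finₚ.toℕ-injective (begin
        toℕ i                                            ≡⟨ weighted-digits k (toℕ i) (Finₚ.toℕ<n i) ⟨
        weighted k (fromBool ∘′ digits k (toℕ i))        ≡⟨ weighted-cong k (λ x → cong fromBool (comb-injective β-basis element≡ x)) ⟩
        weighted k (fromBool ∘′ digits k (toℕ j))        ≡⟨ weighted-digits k (toℕ j) (Finₚ.toℕ<n j) ⟩
        toℕ j                                            ∎)
        where
        open ≡-Reasoning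
        element≡ : element i ≡ element j
        element≡ = W-injective (InSub-comb _) (InSub-comb _)
          (trans (sym (Finₚ.toℕ-fromℕ< (W<2^k (element i)))) (trans (cong toℕ eq) (Finₚ.toℕ-fromℕ< (W<2^k (element j)))))
    ... | j , eq = comb k (digits k (toℕ j)) β , InSub-comb _ ,
                   trans (sym (Finₚ.toℕ-fromℕ< (W<2^k _))) (cong toℕ eq)

module IntegerPowers {n : ℕ} (F : GF (suc n)) where
  open Char2Arithmetic F
  open Fermat F using (fermat)

  infix 4 _≡[N]_
  record _≡[N]_ (a b : ℤ) : Set where
    constructor N∣
    field N∣a-b : ℤ.+ N ℤ∣.∣ (a ℤ.- b)

  ≡[N]-sym : ∀ {a b} → a ≡[N] b → b ≡[N] a
  ≡[N]-sym {a} {b} (N∣ N∣a-b) = N∣ (subst (ℤ.+ N ℤ∣.∣_) (lemma a b) (ℤ∣.∣m⇒∣-m N∣a-b))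
    where
    lemma : ∀ (a b : ℤ) → ℤ.- (a ℤ.- b) ≡ b ℤ.- a
    lemma = solve-∀

  ≡[N]-trans : ∀ {a b c} → a ≡[N] b → b ≡[N] c → a ≡[N] c
  ≡[N]-trans {a} {b} {c} (N∣ N∣a-b) (N∣ N∣b-c) = N∣ (subst (ℤ.+ N ℤ∣.∣_) (lemma a b c) (ℤ∣.∣m∣n⇒∣m+n N∣a-b N∣b-c))
    where
    lemma : ∀ (a b c : ℤ) → (a ℤ.- b) ℤ.+ (b ℤ.- c) ≡ a ℤ.- c
    lemma = solve-∀

  suc-N : suc N ≡ 2 ℕ.^ suc n
  suc-N = ℕₚ.m+[n∸m]≡n (ℕₚ.m^n>0 2 (suc n))

  N≥1 : 1 ≤ N
  N≥1 = ℕₚ.∸-monoˡ-≤ 1 (ℕₚ.*-monoʳ-≤ 2 (ℕₚ.m^n>0 2 n))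

  redExp≡[N] : ∀ z → ℤ.+ redExp z ≡[N] z
  redExp≡[N] z = N∣ (N∣redExp-z N≥1)
    where
    lemma : ∀ (r q d : ℤ) → r ℤ.- (r ℤ.+ q ℤ.* d) ≡ ℤ.- (q ℤ.* d)
    lemma = solve-∀
    N∣redExp-z : 1 ≤ N → ℤ.+ N ℤ∣.∣ (ℤ.+ redExp z ℤ.- z)
    N∣redExp-z _ with N
    ... | suc N′ = subst (ℤ.+ suc N′ ℤ∣.∣_) (sym r-z≡-q*N) (ℤ∣.∣m⇒∣-m (ℤ∣.∣n⇒∣m*n q ℤ∣.∣-refl))
      where
      r : ℕ
      r = z ℤ÷.%ℕ suc N′
      q : ℤ
      q = z ℤ÷./ℕ suc N′
      r-z≡-q*N : ℤ.+ r ℤ.- z ≡ ℤ.- (q ℤ.* ℤ.+ suc N′)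
      r-z≡-q*N = trans (cong (ℤ._-_ (ℤ.+ r)) (ℤ÷.a≡a%ℕn+[a/ℕn]*n z (suc N′))) (lemma (ℤ.+ r) q (ℤ.+ suc N′))

  x^N≡1 : ∀ {x} → ¬ x ≡ 0# → x ^ N ≡ 1#
  x^N≡1 {x} x≢0 = sym (*-cancelˡ x≢0 (begin
    x * 1#        ≡⟨ *-identityʳ x ⟩
    x             ≡⟨ fermat x ⟨
    x ^ (2 ℕ.^ suc n) ≡⟨ cong (x ^_) suc-N ⟨
    x ^ suc N     ∎))
    where open ≡-Reasoning

  ^-cong-≡[N]-≤ : ∀ {x} → ¬ x ≡ 0# → ∀ {a b} → b ≤ a → ℤ.+ a ≡[N] ℤ.+ b → x ^ a ≡ x ^ b
  ^-cong-≡[N]-≤ {x} x≢0 {a} {b} b≤a (N∣ a≡b)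
    with ℤ∣.∣⇒∣ᵤ (subst (ℤ.+ N ℤ∣.∣_) (trans (ℤₚ.m-n≡m⊖n a b) (ℤₚ.⊖-≥ b≤a)) a≡b)
  ... | divides t a∸b≡t*N = begin
    x ^ a                          ≡⟨ cong (x ^_) (ℕₚ.m+[n∸m]≡n b≤a) ⟨
    x ^ (b ℕ.+ (a ℕ.∸ b))          ≡⟨ ^-distribˡ-+-* x b (a ℕ.∸ b) ⟩
    x ^ b * x ^ (a ℕ.∸ b)          ≡⟨ cong (λ w → x ^ b * x ^ w) (trans a∸b≡t*N (ℕₚ.*-comm t N)) ⟩
    x ^ b * x ^ (N ℕ.* t)          ≡⟨ cong (x ^ b *_) (^-*-assoc x N t) ⟨
    x ^ b * (x ^ N) ^ t            ≡⟨ cong (λ w → x ^ b * w ^ t) (x^N≡1 x≢0) ⟩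
    x ^ b * 1# ^ t                 ≡⟨ cong (x ^ b *_) (1^n≡1 t) ⟩
    x ^ b * 1#                     ≡⟨ *-identityʳ _ ⟩
    x ^ b                          ∎
    where open ≡-Reasoning

  ^-cong-≡[N] : ∀ {x} → ¬ x ≡ 0# → ∀ {a b} → ℤ.+ a ≡[N] ℤ.+ b → x ^ a ≡ x ^ b
  ^-cong-≡[N] x≢0 {a} {b} a≡b with ℕₚ.≤-total b a
  ... | inj₁ b≤a = ^-cong-≡[N]-≤ x≢0 b≤a a≡b
  ... | inj₂ a≤b = sym (^-cong-≡[N]-≤ x≢0 a≤b (≡[N]-sym a≡b))

  pw-0 : ∀ z → pw 0# z ≡ 0#
  pw-0 z with 0# ≟ 0#
  ... | yes _ = refl
  ... | no 0≢0 = ⊥-elim (0≢0 refl)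

  pw-≡[N] : ∀ {x} → ¬ x ≡ 0# → ∀ {a z} → ℤ.+ a ≡[N] z → pw x z ≡ x ^ a
  pw-≡[N] {x} x≢0 {a} {z} a≡z with x ≟ 0#
  ... | yes x≡0 = ⊥-elim (x≢0 x≡0)
  ... | no _ = ^-cong-≡[N] x≢0 (≡[N]-trans (redExp≡[N] z) (≡[N]-sym a≡z))

  pw-inverse : ∀ {x} → ¬ x ≡ 0# → ∀ z → pw x z * pw x (ℤ.- z) ≡ 1#
  pw-inverse {x} x≢0 z = begin
    pw x z * pw x (ℤ.- z)    ≡⟨ cong₂ _*_ (pw-≡[N] x≢0 (redExp≡[N] z)) (pw-≡[N] x≢0 (redExp≡[N] (ℤ.- z))) ⟩
    x ^ A * x ^ B            ≡⟨ ^-distribˡ-+-* x A B ⟨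
    x ^ (A ℕ.+ B)            ≡⟨ ^-cong-≡[N] x≢0 A+B≡0 ⟩
    1#                       ∎
    where
    open ≡-Reasoning
    A : ℕ
    A = redExp z
    B : ℕ
    B = redExp (ℤ.- z)
    lemma : ∀ (a b z : ℤ) → (a ℤ.- z) ℤ.+ (b ℤ.- ℤ.- z) ≡ (a ℤ.+ b) ℤ.- ℤ.+ 0
    lemma = solve-∀
    A+B≡0 : ℤ.+ (A ℕ.+ B) ≡[N] ℤ.+ 0
    A+B≡0 = N∣ (subst (ℤ.+ N ℤ∣.∣_) (lemma (ℤ.+ A) (ℤ.+ B) z)
                   (ℤ∣.∣m∣n⇒∣m+n (_≡[N]_.N∣a-b (redExp≡[N] z)) (_≡[N]_.N∣a-b (redExp≡[N] (ℤ.- z)))))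

  pw-InSub : ∀ {k a z} → InSub k a → ℤ.+ (2 ℕ.^ k ℕ.+ 1) ≡[N] z → pw a z ≡ a * a
  pw-InSub {k} {a} {z} a∈ 2^k+1≡z = by-cases (a ≟ 0#)
    where
    by-cases : Dec (a ≡ 0#) → pw a z ≡ a * a
    by-cases (yes refl) = trans (pw-0 z) (sym (zeroˡ 0#))
    by-cases (no a≢0) = trans (pw-≡[N] a≢0 2^k+1≡z) (trans (^-distribˡ-+-* a (2 ℕ.^ k) 1) (cong₂ _*_ a∈ (^-identityʳ a)))

module Classification {n : ℕ} (F : GF (suc n)) (k : ℕ) (k∣m : k ∣ suc n) where
  open Char2Arithmetic F
  open Subfield F k k∣m
  open Encoding F k k∣m
  open IntegerPowers F
  open BinaryWeights F using (weighted-cong)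

  label : Idx k → Carrier
  label (inj₁ _) = 0#
  label (inj₂ (γ , _)) = γ

  InSub-label : ∀ j → InSub k (label j)
  InSub-label (inj₁ _) = InSub-0
  InSub-label (inj₂ (_ , γ∈ , _)) = γ∈

  label-surjective : ∀ γ → InSub k γ → Σ (Idx k) λ j → label j ≡ γ
  label-surjective γ γ∈ with γ ≟ 0#
  ... | yes γ≡0 = inj₁ tt , sym γ≡0
  ... | no γ≢0 = inj₂ (γ , γ∈ , γ≢0) , refl

  module _ {β : Fin k → Carrier} (β-basis : IsBasis k β) where
    open Weight β-basis

    preimages-classified : (c : Pt → Carrier) (f : Pt → ℕ) (fam : Idx k → Pred) →
      (∀ p → InSub k (c p)) → (∀ p → f p ≡ W (c p)) → (∀ j → fam j ≐ (λ p → c p ≡ label j)) →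
      SameFamily (λ (i : Fin (2 ℕ.^ k)) → preimage f (toℕ i)) fam × preimage f 0 ≐ fam (inj₁ tt)
    preimages-classified c f fam c∈ f≡W∘c fam≐ = (preimage→fam , fam→preimage) , preimage≐fam (inj₁ tt) (sym W-0)
      where
      preimage≐fam : ∀ j {t} → t ≡ W (label j) → preimage f t ≐ fam j
      preimage≐fam j t≡ p =
        (λ fp≡t → proj₂ (fam≐ j p) (W-injective (c∈ p) (InSub-label j) (trans (sym (f≡W∘c p)) (trans fp≡t t≡)))) ,
        (λ p∈ → trans (f≡W∘c p) (trans (cong W (proj₁ (fam≐ j p) p∈)) (sym t≡)))
      preimage→fam : ∀ i → Σ (Idx k) λ j → preimage f (toℕ i) ≐ fam j
      preimage→fam i =
        let γ , γ∈ , Wγ≡i = W-surjective i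
            j , labelⱼ≡γ = label-surjective γ γ∈
        in j , preimage≐fam j (trans (sym Wγ≡i) (cong W (sym labelⱼ≡γ)))
      fam→preimage : ∀ j → Σ (Fin (2 ℕ.^ k)) λ i → fam j ≐ preimage f (toℕ i)
      fam→preimage j = fromℕ< (W<2^k (label j)) ,
        λ p → swap (preimage≐fam j (Finₚ.toℕ-fromℕ< (W<2^k (label j))) p)

  2^k+1≡[N]-e : ∀ {e} → e ≡ (ℤ.+ (2 ℕ.^ suc n) ℤ.- ℤ.+ (2 ℕ.^ k)) ℤ.- ℤ.+ 2 → ℤ.+ (2 ℕ.^ k ℕ.+ 1) ≡[N] ℤ.- e
  2^k+1≡[N]-e refl = N∣ (subst (ℤ.+ N ℤ∣.∣_) (sym difference≡N) ℤ∣.∣-refl)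
    where
    open ≡-Reasoning
    P : ℤ
    P = ℤ.+ (2 ℕ.^ suc n)
    K : ℤ
    K = ℤ.+ (2 ℕ.^ k)
    lemma : ∀ P K → (K ℤ.+ ℤ.+ 1) ℤ.- ℤ.- ((P ℤ.- K) ℤ.- ℤ.+ 2) ≡ P ℤ.- ℤ.+ 1
    lemma = solve-∀
    difference≡N : ℤ.+ (2 ℕ.^ k ℕ.+ 1) ℤ.- ℤ.- ((P ℤ.- K) ℤ.- ℤ.+ 2) ≡ ℤ.+ N
    difference≡N = begin
      ℤ.+ (2 ℕ.^ k ℕ.+ 1) ℤ.- ℤ.- ((P ℤ.- K) ℤ.- ℤ.+ 2)  ≡⟨ cong (λ w → w ℤ.- ℤ.- ((P ℤ.- K) ℤ.- ℤ.+ 2)) (ℤₚ.pos-+ (2 ℕ.^ k) 1) ⟩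
      (K ℤ.+ ℤ.+ 1) ℤ.- ℤ.- ((P ℤ.- K) ℤ.- ℤ.+ 2)        ≡⟨ lemma P K ⟩
      P ℤ.- ℤ.+ 1                                      ≡⟨ ℤₚ.m-n≡m⊖n (2 ℕ.^ suc n) 1 ⟩
      2 ℕ.^ suc n ℤ.⊖ 1                                ≡⟨ ℤₚ.⊖-≥ (ℕₚ.m^n>0 2 (suc n)) ⟩
      ℤ.+ N                                            ∎

  classifier : ℤ → Pt → Carrier
  classifier z (a , b) = RelTr k k∣m (pw a z * b)

  InSub-classifier : ∀ z p → InSub k (classifier z p)
  InSub-classifier z (a , b) = RelTr-InSub (pw a z * b)

  classifier-axis : ∀ z b → classifier z (0# , b) ≡ 0#
  classifier-axis z b = trans (cong (λ w → RelTr k k∣m (w * b)) (pw-0 z))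
                              (trans (cong (RelTr k k∣m) (zeroˡ b)) RelTr-0)

  𝒜-axis : ∀ z γ b → ¬ 𝒜 k k∣m z γ (0# , b)
  𝒜-axis z γ b (s , _ , b≡ , off-origin) = off-origin (refl , trans b≡ (trans (cong (s *_) (pw-0 (ℤ.- z))) (zeroʳ s)))

  𝒜-off-axis : ∀ z γ {a b} → ¬ a ≡ 0# →
    (𝒜 k k∣m z γ (a , b) → classifier z (a , b) ≡ γ) × (classifier z (a , b) ≡ γ → 𝒜 k k∣m z γ (a , b))
  𝒜-off-axis z γ {a} {b} a≢0 =
    (λ { (s , RelTr≡γ , b≡ , _) → trans (cong (RelTr k k∣m) (parameter b≡)) RelTr≡γ }) ,
    (λ c≡γ → pw a z * b , c≡γ , on-curve , λ { (a≡0 , _) → a≢0 a≡0 })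
    where
    parameter : ∀ {s} → b ≡ s * pw a (ℤ.- z) → pw a z * b ≡ s
    parameter {s} refl = trans (solve 3 (λ p s q → p :* (s :* q) := s :* (p :* q)) refl (pw a z) s (pw a (ℤ.- z)))
                               (trans (cong (s *_) (pw-inverse a≢0 z)) (*-identityʳ s))
    on-curve : b ≡ (pw a z * b) * pw a (ℤ.- z)
    on-curve = sym (trans (solve 3 (λ p b q → (p :* b) :* q := b :* (p :* q)) refl (pw a z) b (pw a (ℤ.- z)))
                          (trans (cong (b *_) (pw-inverse a≢0 z)) (*-identityʳ b)))



  famA-≐ : ∀ z j → famA k k∣m z j ≐ (λ p → classifier z p ≡ label j)
  famA-≐ z j (a , b) = by-cases (a ≟ 0#) j
    where
    by-cases : Dec (a ≡ 0#) → ∀ j →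
      (famA k k∣m z j (a , b) → classifier z (a , b) ≡ label j) × (classifier z (a , b) ≡ label j → famA k k∣m z j (a , b))
    by-cases (yes refl) (inj₁ _) = (λ _ → classifier-axis z b) , (λ _ → inj₂ refl)
    by-cases (yes refl) (inj₂ (γ , _ , γ≢0)) =
      (λ A → ⊥-elim (𝒜-axis z γ b A)) , (λ c≡γ → ⊥-elim (γ≢0 (trans (sym c≡γ) (classifier-axis z b))))
    by-cases (no a≢0) (inj₁ _) =
      (λ { (inj₁ A) → proj₁ (𝒜-off-axis z 0# a≢0) A ; (inj₂ a≡0) → ⊥-elim (a≢0 a≡0) }) ,
      (λ c≡0 → inj₁ (proj₂ (𝒜-off-axis z 0# a≢0) c≡0))
    by-cases (no a≢0) (inj₂ (γ , _)) = 𝒜-off-axis z γ a≢0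

  famB-≐ : ∀ z j → famB k k∣m z j ≐ (λ (x , y) → classifier z (y , x) ≡ label j)
  famB-≐ z j (x , y) with famA-≐ z j (y , x)
  ... | A→c , c→A = A→c ∘′ B→A j , A→B j ∘′ c→A
    where
    ℬ→𝒜 : ∀ {γ} → ℬ k k∣m z γ (x , y) → 𝒜 k k∣m z γ (y , x)
    ℬ→𝒜 (s , RelTr≡γ , x≡ , off-origin) = s , RelTr≡γ , trans x≡ (*-comm _ s) , λ (y≡0 , x≡0) → off-origin (x≡0 , y≡0)
    𝒜→ℬ : ∀ {γ} → 𝒜 k k∣m z γ (y , x) → ℬ k k∣m z γ (x , y)
    𝒜→ℬ (s , RelTr≡γ , x≡ , off-origin) = s , RelTr≡γ , trans x≡ (*-comm s _) , λ (x≡0 , y≡0) → off-origin (y≡0 , x≡0)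
    B→A : ∀ j → famB k k∣m z j (x , y) → famA k k∣m z j (y , x)
    B→A (inj₁ _) (inj₁ B) = inj₁ (ℬ→𝒜 B)
    B→A (inj₁ _) (inj₂ y≡0) = inj₂ y≡0
    B→A (inj₂ _) B = ℬ→𝒜 B
    A→B : ∀ j → famA k k∣m z j (y , x) → famB k k∣m z j (x , y)
    A→B (inj₁ _) (inj₁ A) = inj₁ (𝒜→ℬ A)
    A→B (inj₁ _) (inj₂ y≡0) = inj₂ y≡0
    A→B (inj₂ _) A = 𝒜→ℬ A

  f₂≡W∘classifier : ∀ {α} (α-basis : IsBasis k α) {e} → ℤ.+ (2 ℕ.^ k ℕ.+ 1) ≡[N] ℤ.- e →
                    ∀ p → f₂ k α e p ≡ Weight.W (squares-basis α-basis) (classifier e p)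
  f₂≡W∘classifier {α} (α∈ , _) {e} 2^k+1≡-e (x , y) = weighted-cong k λ i → cong bit (begin
    Tr (pw (α i) (ℤ.- e) * pw x e * y)          ≡⟨ cong Tr (*-assoc _ _ _) ⟩
    Tr (pw (α i) (ℤ.- e) * (pw x e * y))        ≡⟨ cong (λ w → Tr (w * (pw x e * y))) (pw-InSub {k} (α∈ i) 2^k+1≡-e) ⟩
    Tr (α i * α i * (pw x e * y))               ≡⟨ Tr-RelTr (InSub-* (α∈ i) (α∈ i)) (pw x e * y) ⟩
    Trₖ (α i * α i * classifier e (x , y))      ∎)
    where open ≡-Reasoning

  f₁≡W∘classifier : ∀ {α} (α-basis : IsBasis k α) d x y →
                    f₁ k α d (x , y) ≡ Weight.W α-basis (classifier d (y , x))
  f₁≡W∘classifier {α} (α∈ , _) d x y = weighted-cong k λ i → cong bit (begin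
    Tr (α i * x * pw y d)                       ≡⟨ cong Tr (trans (*-assoc _ _ _) (cong (α i *_) (*-comm x (pw y d)))) ⟩
    Tr (α i * (pw y d * x))                     ≡⟨ Tr-RelTr (α∈ i) (pw y d * x) ⟩
    Trₖ (α i * classifier d (y , x))            ∎)
    where open ≡-Reasoning

-- Opened only now: Data.Nat's _^_ would clash with the field power _^_ used above.
open import Data.Nat as ℕ using (ℕ; _^_; _∸_; _≥_)
open import Data.Nat.GCD using (gcd)
open import Data.Nat.Divisibility using (_∣_)
open import Data.Integer as ℤ using (ℤ; +_)
open import Data.Integer.Divisibility renaming (_∣_ to _∣ℤ_)
open import Data.Fin using (Fin)
open import Data.Product using (_×_)
open import Relation.Binary.PropositionalEquality using (_≡_)

lemma10 : (m : ℕ) → m ≥ 1 → (F : GF m) → (k : ℕ) → (k∣m : k ∣ m)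
  → gcd (2 ^ m ∸ 1) (2 ^ k ℕ.+ 1) ≡ 1
  → (e : ℤ) → e ≡ (+ (2 ^ m) ℤ.- + (2 ^ k)) ℤ.- + 2
  → (d : ℤ) → + (2 ^ m ∸ 1) ∣ℤ (d ℤ.* e ℤ.- + 1)
  → (α : Fin k → Field.Carrier F) → Field.IsBasis F k α
  → Field.SameFamily F (Field.Γ₁ F k α e) (Field.famA F k k∣m e)
    × Field.SameFamily F (Field.Γ₂ F k α d) (Field.famB F k k∣m d)
    × (Field._≐_ F (Field.preimage F (Field.f₂ F k α e) 0) (Field._∪_ F (Field.𝒜 F k k∣m e (Field.0# F)) (Field.U F)))
    × (Field._≐_ F (Field.preimage F (Field.f₁ F k α d) 0) (Field._∪_ F (Field.ℬ F k k∣m d (Field.0# F)) (Field.V F)))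
lemma10 (suc n) _ F k k∣m _ e e≡ d _ α α-basis =
  proj₁ Γ₁-classified , proj₁ Γ₂-classified , proj₂ Γ₁-classified , proj₂ Γ₂-classified
  where
  open Field F using (SameFamily; Γ₁; Γ₂; famA; famB; preimage; f₁; f₂; _≐_; _∪_; 𝒜; ℬ; U; V; 0#)
  open Classification F k k∣m
  open Encoding F k k∣m using (squares-basis)

  Γ₁-classified : SameFamily (Γ₁ k α e) (famA k k∣m e) × preimage (f₂ k α e) 0 ≐ (𝒜 k k∣m e 0# ∪ U)
  Γ₁-classified = preimages-classified (squares-basis α-basis) (classifier e) (f₂ k α e) (famA k k∣m e)
    (InSub-classifier e) (f₂≡W∘classifier α-basis (2^k+1≡[N]-e e≡)) (famA-≐ e)

  Γ₂-classified : SameFamily (Γ₂ k α d) (famB k k∣m d) × preimage (f₁ k α d) 0 ≐ (ℬ k k∣m d 0# ∪ V)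
  Γ₂-classified = preimages-classified α-basis (λ (x , y) → classifier d (y , x)) (f₁ k α d) (famB k k∣m d)
    (λ (x , y) → InSub-classifier d (y , x)) (λ (x , y) → f₁≡W∘classifier α-basis d x y) (famB-≐ d)
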